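{- Let $u\in S_n$, let $C$ be a column of height $k$ filled with distinct elements of $\{1,\dots,n\}$, and fix $i\le k$ such that $C(l)=u(l)$ for all $i<l\le k$. (1) Suppose there is a sequence $k<m_1<\dots<m_p\le n$ such that $u\to u(i,m_1)\to u(i,m_1)(i,m_2)\to\dots\to u(i,m_1)\cdots(i,m_p)$ is a path in the quantum Bruhat graph with edge labels $(i,m_1),\dots,(i,m_p)$ in this order, where $u(m_p)=C(i)$. Then $C(i)\neq u(l)$ for all $l<i$, and $u(i)\prec C(l)\prec C(i)$ fails for all $i<l\le k$. (2) Conversely, if $u(i)\neq C(i)$ and the two conditions in (1) hold (namely $C(i)\ne u(l)$ for $l<i$, and $u(i)\prec C(l)\prec C(i)$ fails for $i<l\le k$), then there is a unique sequence $k<m_1<\dots<m_p\le n$ with the quantum Bruhat graph property in (1) and $u(m_p)=C(i)$; moreover $u(i)\prec u(m_1)\prec\dots\prec u(m_p)=C(i)$.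
   Context: Permutations are in one-line notation; for $a<b$, $(a,b)$ denotes the root $\varepsilon_a-\varepsilon_b$ of type $A_{n-1}$ and the transposition $t_{ab}$, and $w(a,b)$ is $w$ with entries in positions $a,b$ swapped. $\ell$ = number of inversions. The quantum Bruhat graph on $S_n$ has an edge $w\xrightarrow{(a,b)}w(a,b)$ iff $\ell(w(a,b))=\ell(w)+1$ or $\ell(w(a,b))=\ell(w)-2(b-a)+1$. All relations $x\prec y\prec z$ refer to the circular order on $\{1,\dots,n\}$ starting at $x$: $x\prec x+1\prec\dots\prec n\prec1\prec\dots\prec x-1$ (here starting at $u(i)$). -}

module Defs where

open import Data.Nat using (ℕ; _+_; _*_; _∸_; _≤ᵇ_; _<ᵇ_)
import Data.Nat as ℕ
open import Data.Bool using (Bool; true; false; if_then_else_; _∧_)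
open import Data.Fin using (Fin; toℕ; inject≤)
open import Data.Fin.Permutation.Components using (transpose)
open import Data.List using (List; []; _∷_; length; filterᵇ; map; last)
open import Data.Nat.ListAction using (sum)
open import Data.List.Relation.Unary.All using (All)
open import Data.List.Relation.Unary.Linked using (Linked)
open import Data.Maybe using (just)
open import Data.Product using (_×_; ∃)
open import Data.Unit using (⊤)
open import Data.Sum using (_⊎_)
open import Relation.Binary.PropositionalEquality using (_≡_)
import Data.List as L

-- Conventions: 0-based. Positions and values in {1..n} are represented
-- by Fin n (value v ↦ v-1, order-preserving). Permutations of S_n are
-- injective maps Fin n → Fin n in one-line notation.

allFin : (n : ℕ) → List (Fin n)
allFin n = L.allFin n

ℓ : {n : ℕ} → (Fin n → Fin n) → ℕ
ℓ {n} w = sum (map (λ a → length (filterᵇ (λ b → (toℕ a <ᵇ toℕ b) ∧ (toℕ (w b) <ᵇ toℕ (w a))) (allFin n))) (allFin n))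

swapPos : {n : ℕ} → (Fin n → Fin n) → Fin n → Fin n → (Fin n → Fin n)
swapPos w a b x = w (transpose a b x)

-- quantum Bruhat graph edge w --(a,b)--> w(a,b), for a < b:
-- ℓ(w(a,b)) = ℓ(w)+1  or  ℓ(w(a,b)) = ℓ(w) - 2(b-a) + 1 (written without subtraction)
QBGEdge : {n : ℕ} → (Fin n → Fin n) → Fin n → Fin n → Set
QBGEdge w a b =
  toℕ a ℕ.< toℕ b ×
  (ℓ (swapPos w a b) ≡ ℓ w + 1 ⊎ ℓ (swapPos w a b) + 2 * (toℕ b ∸ toℕ a) ≡ ℓ w + 1)

QBGPath : {n : ℕ} → (Fin n → Fin n) → Fin n → List (Fin n) → Set
QBGPath w i [] = ⊤
QBGPath w i (m ∷ ms) = QBGEdge w i m × QBGPath (swapPos w i m) i ms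

-- Position in the circular order starting at x: x ↦ 0, x+1 ↦ 1, …
cyc : {n : ℕ} → Fin n → Fin n → ℕ
cyc {n} x y = if toℕ x ≤ᵇ toℕ y then toℕ y ∸ toℕ x else (toℕ y + n) ∸ toℕ x

-- x ≺ y ≺ z in the circular order starting at x
CircBetween : {n : ℕ} → Fin n → Fin n → Fin n → Set
CircBetween x y z = 0 ℕ.< cyc x y × cyc x y ℕ.< cyc x z

CircChain : {n : ℕ} → Fin n → List (Fin n) → Set
CircChain x ys = Linked (λ a b → cyc x a ℕ.< cyc x b) (x ∷ ys)

-- The sequence k < m₁ < … < m_p ≤ n (1-based), i.e. k ≤ m₁ < … < m_p (0-based),
-- p ≥ 1, with the QBG path property from u with labels (i,m_j), and u(m_p) = C(i).
GoodSeq : {n k : ℕ} → (u : Fin n → Fin n) → (C : Fin k → Fin n) → (k≤n : k ℕ.≤ n)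
          → (i : Fin k) → List (Fin n) → Set
GoodSeq {n} {k} u C k≤n i ms =
  All (λ m → k ℕ.≤ toℕ m) ms ×
  Linked (λ a b → toℕ a ℕ.< toℕ b) ms ×
  QBGPath u (inject≤ i k≤n) ms ×
  ∃ (λ m → last ms ≡ just m × u m ≡ C i)

-- Counting inversions pair by pair shows that w → w(a,b) is an edge of the quantum Bruhat
-- graph exactly when no w(c) with a < c < b lies strictly between w(a) and w(b) in the
-- circular order starting at w(a): for w(a) < w(b) this is the length-one (Bruhat) case, for
-- w(b) < w(a) the quantum case, in which every such w(c) must lie in (w(b), w(a)).
--
-- Rank values by their position in the circular order starting at x₀ = u(i).  Along a path
-- with labels (i,m₁), (i,m₂), … the entry at position i runs through u(m₁), u(m₂), …, and as
-- long as x₀ sits at a position in [i, m_j) the criterion makes these ranks increase and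
-- forbids every value at a position in (i, m_j) to rank strictly between the current entry
-- at i and the end of the path.  Hence m₁ is forced to be the first position beyond i whose
-- value ranks in (rank u(i), rank C(i)], which gives uniqueness; taking it greedily gives
-- existence; and the two conditions on C say exactly that no position in (i, k) qualifies.

module Submission where

open import Defs
open import Data.Bool using (Bool; true; false; T; _∧_; if_then_else_)
open import Data.Bool.Properties using (T-≡)
open import Data.Empty using (⊥; ⊥-elim)
open import Data.Fin using (Fin; zero; suc; toℕ; inject≤; fromℕ<; punchIn; punchOut)
import Data.Fin.Properties as Fin
open import Data.Fin.Properties
  using (_≟_; toℕ-injective; toℕ<n; toℕ-inject≤; toℕ-fromℕ<; punchInᵢ≢i; punchOut-injective; any?;
         injective⇒≤)
open import Data.Fin.Permutation.Components using (transpose)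
import Data.Fin.Permutation as Permutation
open import Data.List using (List; []; _∷_; map; last; filterᵇ; length; tabulate)
open import Data.List.Relation.Unary.All as All using (All; []; _∷_)
open import Data.List.Relation.Unary.Linked.Properties using (Linked⇒All)
open import Data.List.Relation.Unary.Linked as Linked using (Linked; []; [-]; _∷_)
open import Data.Maybe using (just)
import Data.Maybe as Maybe
open import Data.Maybe.Properties using (just-injective)
open import Data.List.Properties using (map-tabulate; map-cong-local; last-map)
open import Data.Nat.ListAction using () renaming (sum to listSum)
open import Data.Nat hiding (_≟_)
import Data.Nat as ℕ
open import Data.Nat.Properties hiding (_≟_)
open import Data.Nat.Tactic.RingSolver using (solve-∀)
open import Data.Product using (_×_; _,_; proj₁; proj₂; ∃)
open import Data.Sum using (_⊎_; inj₁; inj₂; [_,_]′)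
open import Function using (_∘_; id; flip; _⇔_; mk⇔; Equivalence)
open import Function.Definitions using (Injective)
open import Algebra.Properties.Semiring.Sum +-*-semiring
  using (sum; sum-syntax; sum-cong-≗; ∑-distrib-+; *-distribˡ-sum; sum-remove; sum-permute)
open import Relation.Binary.Definitions using (Transitive; Tri; tri<; tri≈; tri>)
open import Relation.Binary.PropositionalEquality
open import Relation.Nullary using (¬_; Dec; does; yes; no)
open import Relation.Nullary.Decidable using (_×-dec_)

private
  variable
    n : ℕ

𝟙 : Bool → ℕ
𝟙 true  = 1
𝟙 false = 0

𝟙-∧ : ∀ p q → 𝟙 (p ∧ q) ≡ 𝟙 p * 𝟙 q
𝟙-∧ true  q = sym (+-identityʳ (𝟙 q))
𝟙-∧ false q = refl

⟦_<_⟧ : ℕ → ℕ → ℕ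
⟦ x < y ⟧ = 𝟙 (x <ᵇ y)

⟦<⟧≡1 : ∀ {x y} → x < y → ⟦ x < y ⟧ ≡ 1
⟦<⟧≡1 {x} {y} x<y with x <ᵇ y | <⇒<ᵇ x<y
... | true | _ = refl

⟦<⟧≡0 : ∀ {x y} → y ≤ x → ⟦ x < y ⟧ ≡ 0
⟦<⟧≡0 {x} {y} y≤x with x <ᵇ y in eq
... | true  = ⊥-elim (≤⇒≯ y≤x (<ᵇ⇒< x y (subst T (sym eq) _)))
... | false = refl

⟦_∈⟨_,_⟩⟧ : ℕ → ℕ → ℕ → ℕ
⟦ y ∈⟨ x , z ⟩⟧ = ⟦ x < y ⟧ * ⟦ y < z ⟧

⟦∈⟧≡1 : ∀ {x y z} → x < y → y < z → ⟦ y ∈⟨ x , z ⟩⟧ ≡ 1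
⟦∈⟧≡1 x<y y<z rewrite ⟦<⟧≡1 x<y | ⟦<⟧≡1 y<z = refl

⟦∈⟧≡0 : ∀ {x y z} → ¬ (x < y × y < z) → ⟦ y ∈⟨ x , z ⟩⟧ ≡ 0
⟦∈⟧≡0 {x} {y} {z} ¬x<y<z with x <? y | y <? z
... | yes x<y | yes y<z = ⊥-elim (¬x<y<z (x<y , y<z))
... | no x≮y  | _       rewrite ⟦<⟧≡0 (≮⇒≥ x≮y) = refl
... | yes _   | no y≮z  rewrite ⟦<⟧≡0 (≮⇒≥ y≮z) = *-zeroʳ ⟦ x < y ⟧

⟦∈⟧-view : ∀ x y z → ⟦ y ∈⟨ x , z ⟩⟧ ≡ 0 ⊎ (x < y × y < z)
⟦∈⟧-view x y z with x <? y | y <? z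
... | yes x<y | yes y<z = inj₂ (x<y , y<z)
... | no x≮y  | _       = inj₁ (⟦∈⟧≡0 {x} {y} {z} (x≮y ∘ proj₁))
... | _       | no y≮z  = inj₁ (⟦∈⟧≡0 {x} {y} {z} (y≮z ∘ proj₂))

⟦<⟧-split-above : ∀ {A B Q} → A < B → Q ≢ A → Q ≢ B → ⟦ B < Q ⟧ + ⟦ Q ∈⟨ A , B ⟩⟧ ≡ ⟦ A < Q ⟧
⟦<⟧-split-above {A} {B} {Q} A<B Q≢A Q≢B with <-cmp Q A
... | tri≈ _ Q≡A _ = ⊥-elim (Q≢A Q≡A)
... | tri< Q<A _ _ rewrite ⟦<⟧≡0 (<⇒≤ (<-trans Q<A A<B)) | ⟦<⟧≡0 (<⇒≤ Q<A) = refl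
... | tri> _ _ A<Q with <-cmp Q B
...   | tri≈ _ Q≡B _ = ⊥-elim (Q≢B Q≡B)
...   | tri< Q<B _ _ rewrite ⟦<⟧≡0 (<⇒≤ Q<B) | ⟦<⟧≡1 A<Q | ⟦<⟧≡1 Q<B = refl
...   | tri> _ _ B<Q rewrite ⟦<⟧≡1 B<Q | ⟦<⟧≡1 A<Q | ⟦<⟧≡0 (<⇒≤ B<Q) = refl

⟦<⟧-split-below : ∀ {A B P} → A < B → P ≢ A → P ≢ B → ⟦ P < A ⟧ + ⟦ P ∈⟨ A , B ⟩⟧ ≡ ⟦ P < B ⟧
⟦<⟧-split-below {A} {B} {P} A<B P≢A P≢B with <-cmp P A
... | tri≈ _ P≡A _ = ⊥-elim (P≢A P≡A)
... | tri< P<A _ _ rewrite ⟦<⟧≡1 P<A | ⟦<⟧≡0 (<⇒≤ P<A) | ⟦<⟧≡1 (<-trans P<A A<B) = refl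
... | tri> _ _ A<P with <-cmp P B
...   | tri≈ _ P≡B _ = ⊥-elim (P≢B P≡B)
...   | tri< P<B _ _ rewrite ⟦<⟧≡0 (<⇒≤ A<P) | ⟦<⟧≡1 A<P | ⟦<⟧≡1 P<B = refl
...   | tri> _ _ B<P rewrite ⟦<⟧≡0 (<⇒≤ A<P) | ⟦<⟧≡1 A<P | ⟦<⟧≡0 (<⇒≤ B<P) = refl

⟦<⟧-split-suc : ∀ {A B} C → A < B → ⟦ C < suc A ⟧ + ⟦ C ∈⟨ A , B ⟩⟧ ≡ ⟦ C < B ⟧
⟦<⟧-split-suc {A} {B} C A<B with <-cmp C A
... | tri< C<A _ _ rewrite ⟦<⟧≡1 (m<n⇒m<1+n C<A) | ⟦<⟧≡0 (<⇒≤ C<A) | ⟦<⟧≡1 (<-trans C<A A<B) = refl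
... | tri≈ _ C≡A _ rewrite ⟦<⟧≡1 (≤-reflexive (cong suc C≡A))
                         | ⟦∈⟧≡0 {A} {C} {B} (λ (A<C , _) → <-irrefl (sym C≡A) A<C)
                         | ⟦<⟧≡1 (subst (_< B) (sym C≡A) A<B) = refl
... | tri> _ _ A<C rewrite ⟦<⟧≡0 A<C | ⟦<⟧≡1 A<C = *-identityˡ ⟦ C < B ⟧

⟦∈⟧≤1 : ∀ x y z → ⟦ y ∈⟨ x , z ⟩⟧ ≤ 1
⟦∈⟧≤1 x y z with ⟦∈⟧-view x y z
... | inj₁ zero≡ = ≤-trans (≤-reflexive zero≡) z≤n
... | inj₂ (x<y , y<z) = ≤-reflexive (⟦∈⟧≡1 x<y y<z)

⟦∈⟧≡1⇒ : ∀ {x y z} → ⟦ y ∈⟨ x , z ⟩⟧ ≡ 1 → x < y × y < z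
⟦∈⟧≡1⇒ {x} {y} {z} one≡ with ⟦∈⟧-view x y z
... | inj₁ zero≡ = ⊥-elim (0≢1+n (trans (sym zero≡) one≡))
... | inj₂ between = between

⟦<⟧-across : ∀ {x y v} → x < y → v ≢ x → v ≢ y →
  ⟦ v < x ⟧ + ⟦ y < v ⟧ + 2 * ⟦ v ∈⟨ x , y ⟩⟧ ≡ ⟦ v < y ⟧ + ⟦ x < v ⟧
⟦<⟧-across {x} {y} {v} x<y v≢x v≢y = trans (regroup ⟦ v < x ⟧ ⟦ y < v ⟧ ⟦ v ∈⟨ x , y ⟩⟧)
  (cong₂ _+_ (⟦<⟧-split-below x<y v≢x v≢y) (⟦<⟧-split-above x<y v≢x v≢y))
  where
  regroup : ∀ p q j → p + q + 2 * j ≡ (p + j) + (q + j)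
  regroup = solve-∀

δ : Fin n → Fin n → ℕ
δ x y = 𝟙 (does (x ≟ y))

δ-refl : (x : Fin n) → δ x x ≡ 1
δ-refl x with x ≟ x
... | yes _   = refl
... | no x≢x  = ⊥-elim (x≢x refl)

δ-≢ : {x y : Fin n} → x ≢ y → δ x y ≡ 0
δ-≢ {x = x} {y} x≢y with x ≟ y
... | yes x≡y = ⊥-elim (x≢y x≡y)
... | no _    = refl

∑-zero : ∑[ x < n ] 0 ≡ 0
∑-zero {zero}  = refl
∑-zero {suc n} = ∑-zero {n}

∑-δ : (a : Fin n) (f : Fin n → ℕ) → ∑[ x < n ] (δ x a * f x) ≡ f a
∑-δ {suc n} a f = begin
  sum selected                                     ≡⟨ sum-remove {i = a} selected ⟩
  δ a a * f a + ∑[ j < n ] selected (punchIn a j)  ≡⟨ cong₂ _+_ (cong (_* f a) (δ-refl a))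
                                                                 (sum-cong-≗ discarded) ⟩
  1 * f a + ∑[ j < n ] 0                           ≡⟨ cong₂ _+_ (*-identityˡ (f a)) (∑-zero {n}) ⟩
  f a + 0                                          ≡⟨ +-identityʳ (f a) ⟩
  f a                                              ∎
  where
  open ≡-Reasoning
  selected : Fin (suc n) → ℕ
  selected x = δ x a * f x
  discarded : ∀ j → selected (punchIn a j) ≡ 0
  discarded j = cong (_* f (punchIn a j)) (δ-≢ (punchInᵢ≢i a j))

∑-mono-≤ : {f g : Fin n → ℕ} → (∀ x → f x ≤ g x) → sum f ≤ sum g
∑-mono-≤ {zero}  f≤g = z≤n
∑-mono-≤ {suc n} f≤g = +-mono-≤ (f≤g zero) (∑-mono-≤ (f≤g ∘ suc))

∑-mono-≡ : {f g : Fin n → ℕ} → (∀ x → f x ≤ g x) → sum f ≡ sum g → ∀ x → f x ≡ g x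
∑-mono-≡ {suc n} {f} {g} f≤g eq = pointwise
  where
  head≡ : f zero ≡ g zero
  head≡ with m≤n⇒m<n∨m≡n (f≤g zero)
  ... | inj₁ f₀<g₀ = ⊥-elim (<-irrefl eq (+-mono-<-≤ f₀<g₀ (∑-mono-≤ (f≤g ∘ suc))))
  ... | inj₂ f₀≡g₀ = f₀≡g₀
  pointwise : ∀ x → f x ≡ g x
  pointwise zero    = head≡
  pointwise (suc x) =
    ∑-mono-≡ (f≤g ∘ suc) (+-cancelˡ-≡ (f zero) _ _ (trans eq (cong (_+ sum (g ∘ suc)) (sym head≡)))) x

∑-below : ∀ K → K ≤ n → ∑[ x < n ] ⟦ toℕ x < K ⟧ ≡ K
∑-below {zero}  zero    _         = refl
∑-below {suc n} zero    _         = ∑-zero {n}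
∑-below {suc n} (suc K) (s≤s K≤n) = cong suc (∑-below K K≤n)

∑-allFin : (f : Fin n → ℕ) → listSum (map f (allFin n)) ≡ ∑[ x < n ] f x
∑-allFin {n} f = trans (cong listSum (map-tabulate id f)) (sum-tabulate f)
  where
  sum-tabulate : ∀ {m} (g : Fin m → ℕ) → listSum (tabulate g) ≡ sum g
  sum-tabulate {zero}  g = refl
  sum-tabulate {suc m} g = cong (g zero +_) (sum-tabulate (g ∘ suc))

length-filterᵇ : ∀ {A : Set} (P : A → Bool) xs → length (filterᵇ P xs) ≡ listSum (map (𝟙 ∘ P) xs)
length-filterᵇ P []       = refl
length-filterᵇ P (x ∷ xs) with P x
... | true  = cong suc (length-filterᵇ P xs)
... | false = length-filterᵇ P xs

module _ {A : Set} {R : A → A → Set} (R-trans : Transitive R) where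

  linked-last : ∀ {x xs p} → Linked R (x ∷ xs) → last (x ∷ xs) ≡ just p → x ≡ p ⊎ R x p
  linked-last {xs = []}    [-]          eq = inj₁ (just-injective eq)
  linked-last {xs = _ ∷ _} (Rxy ∷ Rxs) eq with linked-last Rxs eq
  ... | inj₁ refl = inj₂ Rxy
  ... | inj₂ Ryp  = inj₂ (R-trans Rxy Ryp)

  linked-last⁺ : ∀ {x y xs p} → Linked R (x ∷ y ∷ xs) → last (y ∷ xs) ≡ just p → R x p
  linked-last⁺ (Rxy ∷ Rys) eq with linked-last Rys eq
  ... | inj₁ refl = Rxy
  ... | inj₂ Ryp  = R-trans Rxy Ryp

all-last : ∀ {A : Set} {P : A → Set} {xs p} → All P xs → last xs ≡ just p → P p
all-last (Px ∷ [])         eq = subst _ (just-injective eq) Px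
all-last (_ ∷ Py ∷ Pys)    eq = all-last (Py ∷ Pys) eq

least-witness : {P : Fin n → Set} → (∀ c → Dec (P c)) → ∀ {c} → P c →
  ∃ λ m → P m × (∀ d → toℕ d < toℕ m → ¬ P d)
least-witness {suc n} P? {c} Pc with P? zero
... | yes P₀ = zero , P₀ , λ _ ()
... | no ¬P₀ with c
...   | zero   = ⊥-elim (¬P₀ Pc)
...   | suc c′ with least-witness (P? ∘ suc) Pc
...     | m , Pm , below = suc m , Pm , λ { zero _ → ¬P₀ ; (suc d) d<m → below d (s<s⁻¹ d<m) }

injective⇒surjective : {f : Fin n → Fin n} → Injective _≡_ _≡_ f → ∀ y → ∃ λ x → f x ≡ y
injective⇒surjective {suc n} {f} f-inj y with any? (λ x → f x ≟ y)
... | yes hit = hit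
... | no miss = ⊥-elim (1+n≰n (injective⇒≤ punchOut∘f-injective))
  where
  punchOut∘f : Fin (suc n) → Fin n
  punchOut∘f x = punchOut {i = y} (miss ∘ (x ,_) ∘ sym)
  punchOut∘f-injective : Injective _≡_ _≡_ punchOut∘f
  punchOut∘f-injective {x} {x′} eq =
    f-inj (punchOut-injective (miss ∘ (x ,_) ∘ sym) (miss ∘ (x′ ,_) ∘ sym) eq)

-- Transpositions and inversions

module _ {n : ℕ} (a b : Fin n) where

  transpose-matchˡ : transpose a b a ≡ b
  transpose-matchˡ with a ≟ a
  ... | yes _   = refl
  ... | no a≢a  = ⊥-elim (a≢a refl)

  transpose-matchʳ : transpose a b b ≡ a
  transpose-matchʳ with b ≟ a
  ... | yes b≡a = b≡a
  ... | no _ with b ≟ b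
  ...   | yes _  = refl
  ...   | no b≢b = ⊥-elim (b≢b refl)

  transpose-other : ∀ {c} → c ≢ a → c ≢ b → transpose a b c ≡ c
  transpose-other {c} c≢a c≢b with c ≟ a
  ... | yes c≡a = ⊥-elim (c≢a c≡a)
  ... | no _ with c ≟ b
  ...   | yes c≡b = ⊥-elim (c≢b c≡b)
  ...   | no _    = refl

  transpose-involutive : ∀ c → transpose a b (transpose a b c) ≡ c
  transpose-involutive c with c ≟ a
  ... | yes refl = transpose-matchʳ
  ... | no c≢a with c ≟ b
  ...   | yes refl = transpose-matchˡ
  ...   | no c≢b   = transpose-other c≢a c≢b

  ∑-transpose : (f : Fin n → ℕ) → sum f ≡ sum (f ∘ transpose a b)
  ∑-transpose f = sum-permute f (Permutation.transpose a b)

  module _ (w : Fin n → Fin n) where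

    swapPos-matchˡ : swapPos w a b a ≡ w b
    swapPos-matchˡ = cong w transpose-matchˡ

    swapPos-matchʳ : swapPos w a b b ≡ w a
    swapPos-matchʳ = cong w transpose-matchʳ

    swapPos-other : ∀ {c} → c ≢ a → c ≢ b → swapPos w a b c ≡ w c
    swapPos-other c≢a c≢b = cong w (transpose-other c≢a c≢b)

    swapPos-involutive : ∀ c → swapPos (swapPos w a b) a b c ≡ w c
    swapPos-involutive c = cong w (transpose-involutive c)

    swapPos-injective : Injective _≡_ _≡_ w → Injective _≡_ _≡_ (swapPos w a b)
    swapPos-injective w-inj {x} {y} eq = begin
      x                               ≡⟨ transpose-involutive x ⟨
      transpose a b (transpose a b x) ≡⟨ cong (transpose a b) (w-inj eq) ⟩
      transpose a b (transpose a b y) ≡⟨ transpose-involutive y ⟩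
      y                               ∎
      where open ≡-Reasoning

-- Opaque, so that unification sees ∑² applied to a summand rather than an unfolded fold.
opaque
  ∑² : (Fin n → Fin n → ℕ) → ℕ
  ∑² {n} f = ∑[ p < n ] ∑[ q < n ] f p q

  ∑²-cong : {f g : Fin n → Fin n → ℕ} → (∀ p q → f p q ≡ g p q) → ∑² f ≡ ∑² g
  ∑²-cong f≗g = sum-cong-≗ (sum-cong-≗ ∘ f≗g)

  ∑²-distrib-+ : {f g : Fin n → Fin n → ℕ} → ∑² (λ p q → f p q + g p q) ≡ ∑² f + ∑² g
  ∑²-distrib-+ {n} {f} {g} =
    trans (sum-cong-≗ λ p → ∑-distrib-+ (f p) (g p)) (∑-distrib-+ {n} (sum ∘ f) (sum ∘ g))

  ∑²-δˡ : (a : Fin n) (f : Fin n → Fin n → ℕ) → ∑² (λ p q → δ p a * f p q) ≡ ∑[ q < n ] f a q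
  ∑²-δˡ a f = trans (sum-cong-≗ λ p → sym (*-distribˡ-sum (δ p a) (f p))) (∑-δ a (λ p → sum (f p)))

  ∑²-δʳ : (b : Fin n) (f : Fin n → Fin n → ℕ) → ∑² (λ p q → δ q b * f p q) ≡ ∑[ p < n ] f p b
  ∑²-δʳ b f = sum-cong-≗ λ p → ∑-δ b (f p)

∑²-distrib-+₃ : {f g h : Fin n → Fin n → ℕ} → ∑² (λ p q → f p q + g p q + h p q) ≡ ∑² f + ∑² g + ∑² h
∑²-distrib-+₃ {h = h} = trans ∑²-distrib-+ (cong (_+ ∑² h) ∑²-distrib-+)

⟦_<ᶠ_⟧ : Fin n → Fin n → ℕ
⟦ p <ᶠ q ⟧ = ⟦ toℕ p < toℕ q ⟧

inversion : (Fin n → Fin n) → Fin n → Fin n → ℕ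
inversion w p q = ⟦ p <ᶠ q ⟧ * ⟦ w q <ᶠ w p ⟧

opaque
  unfolding ∑²

  ℓ≡∑inversion : (w : Fin n → Fin n) → ℓ w ≡ ∑² (inversion w)
  ℓ≡∑inversion {n} w = trans (∑-allFin {n} _) (sum-cong-≗ λ p →
    trans (length-filterᵇ _ (allFin n)) (trans (∑-allFin {n} _) (sum-cong-≗ λ q →
      𝟙-∧ (toℕ p <ᵇ toℕ q) (toℕ (w q) <ᵇ toℕ (w p)))))

  -- Reindexing the double sum by the transposition moves it from the values to the positions.
  ℓ-swapPos : (w : Fin n → Fin n) (a b : Fin n) →
    ℓ (swapPos w a b) ≡ ∑² (λ p q → ⟦ transpose a b p <ᶠ transpose a b q ⟧ * ⟦ w q <ᶠ w p ⟧)
  ℓ-swapPos w a b = trans (ℓ≡∑inversion (swapPos w a b)) (trans (∑-transpose a b _) (sum-cong-≗ λ p →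
    trans (∑-transpose a b _) (sum-cong-≗ λ q →
      cong₂ (λ s t → ⟦ transpose a b p <ᶠ transpose a b q ⟧ * ⟦ w s <ᶠ w t ⟧)
            (transpose-involutive a b q) (transpose-involutive a b p))))

ℓ-cong : {v w : Fin n → Fin n} → (∀ x → v x ≡ w x) → ℓ v ≡ ℓ w
ℓ-cong {v = v} {w} v≗w = begin
  ℓ v                  ≡⟨ ℓ≡∑inversion v ⟩
  ∑² (inversion v)     ≡⟨ ∑²-cong (λ p q → cong₂ (λ s t → ⟦ p <ᶠ q ⟧ * ⟦ s <ᶠ t ⟧) (v≗w q) (v≗w p)) ⟩
  ∑² (inversion w)     ≡⟨ ℓ≡∑inversion w ⟨
  ℓ w                  ∎
  where open ≡-Reasoning

-- The length of w(a,b)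

module TranspositionLength {n : ℕ} (a b : Fin n) (a<b : toℕ a < toℕ b) where

  private
    t : Fin n → Fin n
    t = transpose a b

    a≢b : a ≢ b
    a≢b = Fin.<⇒≢ a<b

    toℕ-≢ : {x y : Fin n} → x ≢ y → toℕ x ≢ toℕ y
    toℕ-≢ x≢y = x≢y ∘ toℕ-injective

  inside : Fin n → ℕ
  inside c = ⟦ toℕ c ∈⟨ toℕ a , toℕ b ⟩⟧

  private
    inside-a : inside a ≡ 0
    inside-a = ⟦∈⟧≡0 {toℕ a} {toℕ a} {toℕ b} (λ (a<a , _) → <-irrefl refl a<a)

    inside-b : inside b ≡ 0
    inside-b = ⟦∈⟧≡0 {toℕ a} {toℕ b} {toℕ b} (λ (_ , b<b) → <-irrefl refl b<b)

  -- The pairs p < q whose order t reverses, and the pairs p > q whose order t restores.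
  lostAscent gainedAscent : Fin n → Fin n → ℕ
  lostAscent   p q = δ p a * δ q b + δ p a * inside q + δ q b * inside p
  gainedAscent p q = δ p b * δ q a + δ q a * inside p + δ p b * inside q

  private
    data Role (p : Fin n) : Set where
      isA   : p ≡ a → Role p
      isB   : p ≡ b → Role p
      other : p ≢ a → p ≢ b → Role p

    role : ∀ p → Role p
    role p with p ≟ a | p ≟ b
    ... | yes p≡a | _       = isA p≡a
    ... | no _    | yes p≡b = isB p≡b
    ... | no p≢a  | no p≢b  = other p≢a p≢b

  ascent-transpose : ∀ p q → ⟦ t p <ᶠ t q ⟧ + lostAscent p q ≡ ⟦ p <ᶠ q ⟧ + gainedAscent p q
  ascent-transpose p q = by-roles (role p) (role q)
    where
    b≮a = ⟦<⟧≡0 (<⇒≤ a<b)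
    a<b′ = ⟦<⟧≡1 a<b
    by-roles : Role p → Role q → ⟦ t p <ᶠ t q ⟧ + lostAscent p q ≡ ⟦ p <ᶠ q ⟧ + gainedAscent p q
    by-roles (isA refl) (isA refl)
      rewrite transpose-matchˡ a b | δ-refl a | δ-≢ a≢b | inside-a
            | ⟦<⟧≡0 (≤-refl {toℕ b}) | ⟦<⟧≡0 (≤-refl {toℕ a}) = refl
    by-roles (isA refl) (isB refl)
      rewrite transpose-matchˡ a b | transpose-matchʳ a b | δ-refl a | δ-refl b | δ-≢ a≢b | δ-≢ (a≢b ∘ sym)
            | inside-a | inside-b | b≮a | a<b′ = refl
    by-roles (isA refl) (other q≢a q≢b)
      rewrite transpose-matchˡ a b | transpose-other a b q≢a q≢b | δ-refl a | δ-≢ a≢b | δ-≢ q≢a | δ-≢ q≢b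
            | +-identityʳ ⟦ a <ᶠ q ⟧ =
      trans (cong (⟦ b <ᶠ q ⟧ +_) (trans (+-identityʳ _) (+-identityʳ _)))
            (⟦<⟧-split-above a<b (toℕ-≢ q≢a) (toℕ-≢ q≢b))
    by-roles (isB refl) (isA refl)
      rewrite transpose-matchˡ a b | transpose-matchʳ a b | δ-refl a | δ-refl b | δ-≢ a≢b | δ-≢ (a≢b ∘ sym)
            | inside-a | inside-b | b≮a | a<b′ = refl
    by-roles (isB refl) (isB refl)
      rewrite transpose-matchʳ a b | δ-refl b | δ-≢ (a≢b ∘ sym) | inside-b
            | ⟦<⟧≡0 (≤-refl {toℕ a}) | ⟦<⟧≡0 (≤-refl {toℕ b}) = refl
    by-roles (isB refl) (other q≢a q≢b)
      rewrite transpose-matchʳ a b | transpose-other a b q≢a q≢b | δ-refl b | δ-≢ (a≢b ∘ sym)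
            | δ-≢ q≢a | δ-≢ q≢b
            | +-identityʳ ⟦ a <ᶠ q ⟧ =
      sym (trans (cong (⟦ b <ᶠ q ⟧ +_) (+-identityʳ _)) (⟦<⟧-split-above a<b (toℕ-≢ q≢a) (toℕ-≢ q≢b)))
    by-roles (other p≢a p≢b) (isA refl)
      rewrite transpose-matchˡ a b | transpose-other a b p≢a p≢b | δ-refl a | δ-≢ a≢b | δ-≢ p≢a | δ-≢ p≢b
            | +-identityʳ ⟦ p <ᶠ b ⟧ =
      sym (trans (cong (⟦ p <ᶠ a ⟧ +_) (trans (+-identityʳ _) (+-identityʳ _)))
                 (⟦<⟧-split-below a<b (toℕ-≢ p≢a) (toℕ-≢ p≢b)))
    by-roles (other p≢a p≢b) (isB refl)
      rewrite transpose-matchʳ a b | transpose-other a b p≢a p≢b | δ-refl b | δ-≢ (a≢b ∘ sym)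
            | δ-≢ p≢a | δ-≢ p≢b
            | +-identityʳ ⟦ p <ᶠ b ⟧ =
      trans (cong (⟦ p <ᶠ a ⟧ +_) (+-identityʳ _)) (⟦<⟧-split-below a<b (toℕ-≢ p≢a) (toℕ-≢ p≢b))
    by-roles (other p≢a p≢b) (other q≢a q≢b)
      rewrite transpose-other a b p≢a p≢b | transpose-other a b q≢a q≢b
            | δ-≢ p≢a | δ-≢ p≢b | δ-≢ q≢a | δ-≢ q≢b = refl

  valuesBetween : (Fin n → Fin n) → ℕ → ℕ → ℕ
  valuesBetween w lo hi = ∑[ c < n ] (inside c * ⟦ toℕ (w c) ∈⟨ lo , hi ⟩⟧)

  module _ (w : Fin n → Fin n) where

    private
      W : Fin n → Fin n → ℕ
      W p q = ⟦ w q <ᶠ w p ⟧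

      expand : ∀ d₁ d₂ j₁ j₂ x →
        (d₁ * d₂ + d₁ * j₁ + d₂ * j₂) * x ≡ d₁ * (d₂ * x) + d₁ * (j₁ * x) + d₂ * (j₂ * x)
      expand = solve-∀

    middleInversions middleNonInversions : ℕ
    middleInversions    = ∑[ c < n ] (inside c * W a c) + ∑[ c < n ] (inside c * W c b)
    middleNonInversions = ∑[ c < n ] (inside c * W b c) + ∑[ c < n ] (inside c * W c a)

    ∑²-lostAscent : ∑² (λ p q → lostAscent p q * W p q) ≡ W a b + middleInversions
    ∑²-lostAscent = begin
      ∑² (λ p q → lostAscent p q * W p q)
        ≡⟨ ∑²-cong (λ p q → expand (δ p a) (δ q b) (inside q) (inside p) (W p q)) ⟩
      ∑² (λ p q → δ p a * (δ q b * W p q) + δ p a * (inside q * W p q) + δ q b * (inside p * W p q))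
        ≡⟨ ∑²-distrib-+₃ ⟩
      ∑² (λ p q → δ p a * (δ q b * W p q)) + ∑² (λ p q → δ p a * (inside q * W p q))
        + ∑² (λ p q → δ q b * (inside p * W p q))
        ≡⟨ cong₂ _+_ (cong₂ _+_ (trans (∑²-δˡ a _) (∑-δ b (W a))) (∑²-δˡ a _)) (∑²-δʳ b _) ⟩
      W a b + ∑[ c < n ] (inside c * W a c) + ∑[ c < n ] (inside c * W c b)
        ≡⟨ +-assoc (W a b) _ _ ⟩
      W a b + middleInversions ∎
      where open ≡-Reasoning

    ∑²-gainedAscent : ∑² (λ p q → gainedAscent p q * W p q) ≡ W b a + middleNonInversions
    ∑²-gainedAscent = begin
      ∑² (λ p q → gainedAscent p q * W p q)
        ≡⟨ ∑²-cong (λ p q → trans (cong (_* W p q) (rearrange (δ p b) (δ q a) (inside p) (inside q)))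
                                  (expand (δ p b) (δ q a) (inside q) (inside p) (W p q))) ⟩
      ∑² (λ p q → δ p b * (δ q a * W p q) + δ p b * (inside q * W p q) + δ q a * (inside p * W p q))
        ≡⟨ ∑²-distrib-+₃ ⟩
      ∑² (λ p q → δ p b * (δ q a * W p q)) + ∑² (λ p q → δ p b * (inside q * W p q))
        + ∑² (λ p q → δ q a * (inside p * W p q))
        ≡⟨ cong₂ _+_ (cong₂ _+_ (trans (∑²-δˡ b _) (∑-δ a (W b))) (∑²-δˡ b _)) (∑²-δʳ a _) ⟩
      W b a + ∑[ c < n ] (inside c * W b c) + ∑[ c < n ] (inside c * W c a)
        ≡⟨ +-assoc (W b a) _ _ ⟩
      W b a + middleNonInversions ∎
      where
      open ≡-Reasoning
      rearrange : ∀ d₁ d₂ j₁ j₂ → d₁ * d₂ + d₂ * j₁ + d₁ * j₂ ≡ d₁ * d₂ + d₁ * j₂ + d₂ * j₁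
      rearrange = solve-∀

    ℓ-exchange : ℓ (swapPos w a b) + ∑² (λ p q → lostAscent p q * W p q)
               ≡ ℓ w + ∑² (λ p q → gainedAscent p q * W p q)
    ℓ-exchange = begin
      ℓ (swapPos w a b) + ∑² (λ p q → lostAscent p q * W p q)
        ≡⟨ cong (_+ ∑² (λ p q → lostAscent p q * W p q)) (ℓ-swapPos w a b) ⟩
      ∑² (λ p q → ⟦ t p <ᶠ t q ⟧ * W p q) + ∑² (λ p q → lostAscent p q * W p q)
        ≡⟨ ∑²-distrib-+ ⟨
      ∑² (λ p q → ⟦ t p <ᶠ t q ⟧ * W p q + lostAscent p q * W p q)
        ≡⟨ ∑²-cong (λ p q → trans (sym (*-distribʳ-+ (W p q) ⟦ t p <ᶠ t q ⟧ (lostAscent p q)))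
                              (trans (cong (_* W p q) (ascent-transpose p q))
                                     (*-distribʳ-+ (W p q) ⟦ p <ᶠ q ⟧ (gainedAscent p q)))) ⟩
      ∑² (λ p q → inversion w p q + gainedAscent p q * W p q)
        ≡⟨ ∑²-distrib-+ ⟩
      ∑² (inversion w) + ∑² (λ p q → gainedAscent p q * W p q)
        ≡⟨ cong (_+ ∑² (λ p q → gainedAscent p q * W p q)) (ℓ≡∑inversion w) ⟨
      ℓ w + ∑² (λ p q → gainedAscent p q * W p q) ∎
      where open ≡-Reasoning

    module _ (w-inj : Injective _≡_ _≡_ w) (x<y : toℕ (w a) < toℕ (w b)) where

      private
        x y : ℕ
        x = toℕ (w a)
        y = toℕ (w b)

      -- Each c with w(a) < w(c) < w(b) is a non-inversion with both a and b,
      -- any other c with exactly one of them.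
      middleNonInversions-ascent : middleNonInversions ≡ middleInversions + 2 * valuesBetween w x y
      middleNonInversions-ascent = begin
        middleNonInversions
          ≡⟨ ∑-distrib-+ (λ c → inside c * W b c) (λ c → inside c * W c a) ⟨
        ∑[ c < n ] (inside c * W b c + inside c * W c a)
          ≡⟨ sum-cong-≗ pointwise ⟨
        ∑[ c < n ] (inside c * W a c + inside c * W c b + 2 * (inside c * between c))
          ≡⟨ ∑-distrib-+ (λ c → inside c * W a c + inside c * W c b) (λ c → 2 * (inside c * between c)) ⟩
        ∑[ c < n ] (inside c * W a c + inside c * W c b) + ∑[ c < n ] (2 * (inside c * between c))
          ≡⟨ cong₂ _+_ (sym (∑-distrib-+ (λ c → inside c * W a c) (λ c → inside c * W c b)))
                       (*-distribˡ-sum 2 (λ c → inside c * between c)) ⟨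
        middleInversions + 2 * valuesBetween w x y ∎
        where
        open ≡-Reasoning
        between : Fin n → ℕ
        between c = ⟦ toℕ (w c) ∈⟨ x , y ⟩⟧
        factor : ∀ j p q r → j * p + j * q + 2 * (j * r) ≡ j * (p + q + 2 * r)
        factor = solve-∀
        value≢ : ∀ {c d} → c ≢ d → toℕ (w c) ≢ toℕ (w d)
        value≢ c≢d = c≢d ∘ w-inj ∘ toℕ-injective
        pointwise : ∀ c → inside c * W a c + inside c * W c b + 2 * (inside c * between c)
                        ≡ inside c * W b c + inside c * W c a
        pointwise c with ⟦∈⟧-view (toℕ a) (toℕ c) (toℕ b)
        ... | inj₁ inside≡0 rewrite inside≡0 = refl
        ... | inj₂ (a<c , c<b) = begin
          inside c * W a c + inside c * W c b + 2 * (inside c * between c)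
            ≡⟨ factor (inside c) (W a c) (W c b) (between c) ⟩
          inside c * (W a c + W c b + 2 * between c)
            ≡⟨ cong (inside c *_) (⟦<⟧-across x<y (value≢ (≢-sym (Fin.<⇒≢ a<c))) (value≢ (Fin.<⇒≢ c<b))) ⟩
          inside c * (W b c + W c a)
            ≡⟨ *-distribˡ-+ (inside c) (W b c) (W c a) ⟩
          inside c * W b c + inside c * W c a ∎

      ℓ-swapPos-ascent : ℓ (swapPos w a b) ≡ ℓ w + 1 + 2 * valuesBetween w x y
      ℓ-swapPos-ascent = +-cancelʳ-≡ middleInversions _ _ (begin
        ℓ (swapPos w a b) + middleInversions
          ≡⟨ cong (λ e → ℓ (swapPos w a b) + (e + middleInversions)) (⟦<⟧≡0 (<⇒≤ x<y)) ⟨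
        ℓ (swapPos w a b) + (W a b + middleInversions)
          ≡⟨ cong (ℓ (swapPos w a b) +_) ∑²-lostAscent ⟨
        ℓ (swapPos w a b) + ∑² (λ p q → lostAscent p q * W p q)
          ≡⟨ ℓ-exchange ⟩
        ℓ w + ∑² (λ p q → gainedAscent p q * W p q)
          ≡⟨ cong (ℓ w +_) ∑²-gainedAscent ⟩
        ℓ w + (W b a + middleNonInversions)
          ≡⟨ cong₂ (λ e r → ℓ w + (e + r)) (⟦<⟧≡1 x<y) middleNonInversions-ascent ⟩
        ℓ w + (1 + (middleInversions + 2 * valuesBetween w x y))
          ≡⟨ regroup (ℓ w) middleInversions (valuesBetween w x y) ⟩
        ℓ w + 1 + 2 * valuesBetween w x y + middleInversions ∎)
        where
        open ≡-Reasoning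
        regroup : ∀ l s r → l + (1 + (s + 2 * r)) ≡ l + 1 + 2 * r + s
        regroup = solve-∀

  valuesBetween-cong : ∀ {v w : Fin n → Fin n} {lo hi} →
    (∀ c → toℕ a < toℕ c → toℕ c < toℕ b → v c ≡ w c) → valuesBetween v lo hi ≡ valuesBetween w lo hi
  valuesBetween-cong {v} {w} {lo} {hi} v≗w = sum-cong-≗ pointwise
    where
    pointwise : ∀ c → inside c * ⟦ toℕ (v c) ∈⟨ lo , hi ⟩⟧ ≡ inside c * ⟦ toℕ (w c) ∈⟨ lo , hi ⟩⟧
    pointwise c with ⟦∈⟧-view (toℕ a) (toℕ c) (toℕ b)
    ... | inj₁ inside≡0 rewrite inside≡0 = refl
    ... | inj₂ (a<c , c<b) rewrite v≗w c a<c c<b = refl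

  -- The descent case is the ascent case for w(a,b), since swapping twice is the identity.
  ℓ-swapPos-descent : (w : Fin n → Fin n) → Injective _≡_ _≡_ w → toℕ (w b) < toℕ (w a) →
    ℓ (swapPos w a b) + 1 + 2 * valuesBetween w (toℕ (w b)) (toℕ (w a)) ≡ ℓ w
  ℓ-swapPos-descent w w-inj y<x = begin
    ℓ w′ + 1 + 2 * valuesBetween w (toℕ (w b)) (toℕ (w a))
      ≡⟨ cong (λ N → ℓ w′ + 1 + 2 * N) agree ⟨
    ℓ w′ + 1 + 2 * valuesBetween w′ (toℕ (w′ a)) (toℕ (w′ b))
      ≡⟨ ℓ-swapPos-ascent w′ (swapPos-injective a b w w-inj) y<x′ ⟨
    ℓ (swapPos w′ a b)
      ≡⟨ ℓ-cong (swapPos-involutive a b w) ⟩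
    ℓ w ∎
    where
    open ≡-Reasoning
    w′ = swapPos w a b
    y<x′ : toℕ (w′ a) < toℕ (w′ b)
    y<x′ = subst₂ (λ s r → toℕ s < toℕ r) (sym (swapPos-matchˡ a b w)) (sym (swapPos-matchʳ a b w)) y<x
    agree : valuesBetween w′ (toℕ (w′ a)) (toℕ (w′ b)) ≡ valuesBetween w (toℕ (w b)) (toℕ (w a))
    agree = trans (cong₂ (valuesBetween w′) (cong toℕ (swapPos-matchˡ a b w))
                                            (cong toℕ (swapPos-matchʳ a b w)))
                  (valuesBetween-cong {lo = toℕ (w b)} {hi = toℕ (w a)}
                     (λ c a<c c<b → swapPos-other a b w (≢-sym (Fin.<⇒≢ a<c)) (Fin.<⇒≢ c<b)))

  b∸a≡1+∑inside : toℕ b ∸ toℕ a ≡ suc (∑[ c < n ] inside c)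
  b∸a≡1+∑inside = begin
    toℕ b ∸ toℕ a          ≡⟨ cong (_∸ toℕ a) count ⟨
    toℕ a + suc S ∸ toℕ a  ≡⟨ m+n∸m≡n (toℕ a) (suc S) ⟩
    suc S                  ∎
    where
    open ≡-Reasoning
    S = ∑[ c < n ] inside c
    count : toℕ a + suc S ≡ toℕ b
    count = begin
      toℕ a + suc S
        ≡⟨ +-suc (toℕ a) S ⟩
      suc (toℕ a) + S
        ≡⟨ cong (_+ S) (∑-below (suc (toℕ a)) (<-trans a<b (toℕ<n b))) ⟨
      ∑[ c < n ] ⟦ toℕ c < suc (toℕ a) ⟧ + S
        ≡⟨ ∑-distrib-+ (λ c → ⟦ toℕ c < suc (toℕ a) ⟧) inside ⟨
      ∑[ c < n ] (⟦ toℕ c < suc (toℕ a) ⟧ + inside c)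
        ≡⟨ sum-cong-≗ {n} (λ c → ⟦<⟧-split-suc (toℕ c) a<b) ⟩
      ∑[ c < n ] ⟦ toℕ c < toℕ b ⟧
        ≡⟨ ∑-below (toℕ b) (<⇒≤ (toℕ<n b)) ⟩
      toℕ b ∎

  module _ {w : Fin n → Fin n} {lo hi : ℕ} where

    private
      term : Fin n → ℕ
      term c = inside c * ⟦ toℕ (w c) ∈⟨ lo , hi ⟩⟧

    valuesBetween≡0⇔ : valuesBetween w lo hi ≡ 0 ⇔
      (∀ c → toℕ a < toℕ c → toℕ c < toℕ b → ¬ (lo < toℕ (w c) × toℕ (w c) < hi))
    valuesBetween≡0⇔ = mk⇔
      (λ N≡0 c a<c c<b (lo<v , v<hi) → 0≢1+n (begin
        0       ≡⟨ ∑-mono-≡ (λ _ → z≤n) (trans (∑-zero {n}) (sym N≡0)) c ⟩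
        term c  ≡⟨ cong₂ _*_ (⟦∈⟧≡1 a<c c<b) (⟦∈⟧≡1 lo<v v<hi) ⟩
        1       ∎))
      (λ none → trans (sum-cong-≗ (vanishes none)) (∑-zero {n}))
      where
      open ≡-Reasoning
      vanishes : (∀ c → toℕ a < toℕ c → toℕ c < toℕ b → ¬ (lo < toℕ (w c) × toℕ (w c) < hi)) →
                 ∀ c → term c ≡ 0
      vanishes none c with ⟦∈⟧-view (toℕ a) (toℕ c) (toℕ b)
      ... | inj₁ inside≡0 rewrite inside≡0 = refl
      ... | inj₂ (a<c , c<b) rewrite ⟦∈⟧≡0 {lo} {toℕ (w c)} {hi} (none c a<c c<b) = *-zeroʳ (inside c)

    valuesBetween≡∑⇔ : valuesBetween w lo hi ≡ ∑[ c < n ] inside c ⇔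
      (∀ c → toℕ a < toℕ c → toℕ c < toℕ b → lo < toℕ (w c) × toℕ (w c) < hi)
    valuesBetween≡∑⇔ = mk⇔
      (λ N≡S c a<c c<b → ⟦∈⟧≡1⇒ (begin
        ⟦ toℕ (w c) ∈⟨ lo , hi ⟩⟧      ≡⟨ *-identityˡ _ ⟨
        1 * ⟦ toℕ (w c) ∈⟨ lo , hi ⟩⟧  ≡⟨ cong (_* ⟦ toℕ (w c) ∈⟨ lo , hi ⟩⟧) (⟦∈⟧≡1 a<c c<b) ⟨
        term c                         ≡⟨ ∑-mono-≡ term≤inside N≡S c ⟩
        inside c                       ≡⟨ ⟦∈⟧≡1 a<c c<b ⟩
        1                              ∎))
      (λ all → sum-cong-≗ (saturates all))
      where
      open ≡-Reasoning
      term≤inside : ∀ c → term c ≤ inside c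
      term≤inside c = ≤-trans (*-monoʳ-≤ (inside c) (⟦∈⟧≤1 lo (toℕ (w c)) hi)) (≤-reflexive (*-identityʳ _))
      saturates : (∀ c → toℕ a < toℕ c → toℕ c < toℕ b → lo < toℕ (w c) × toℕ (w c) < hi) →
                  ∀ c → term c ≡ inside c
      saturates all c with ⟦∈⟧-view (toℕ a) (toℕ c) (toℕ b)
      ... | inj₁ inside≡0 rewrite inside≡0 = refl
      ... | inj₂ (a<c , c<b) rewrite ⟦∈⟧≡1 (proj₁ (all c a<c c<b)) (proj₂ (all c a<c c<b)) = *-identityʳ _

  module _ {w : Fin n → Fin n} (w-inj : Injective _≡_ _≡_ w) where

    private
      x y S : ℕ
      x = toℕ (w a)
      y = toℕ (w b)
      S = ∑[ c < n ] inside c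

      twice : ∀ l s → l + 2 * suc s ≡ l + 2 + 2 * s
      twice = solve-∀

      shift : ∀ l r → l + 1 + 2 * r + 1 ≡ l + 2 + 2 * r
      shift = solve-∀

    bruhat-ascent⇔ : x < y → ℓ (swapPos w a b) ≡ ℓ w + 1 ⇔ valuesBetween w x y ≡ 0
    bruhat-ascent⇔ x<y = mk⇔
      (λ ℓ′≡ℓ+1 → *-cancelˡ-≡ N 0 2 (+-cancelˡ-≡ (ℓ w + 1) _ _
                    (trans (sym formula) (trans ℓ′≡ℓ+1 (sym (+-identityʳ (ℓ w + 1)))))))
      (λ N≡0 → trans formula (trans (cong (λ N → ℓ w + 1 + 2 * N) N≡0) (+-identityʳ (ℓ w + 1))))
      where
      N = valuesBetween w x y
      formula = ℓ-swapPos-ascent w w-inj x<y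

    quantum-ascent-impossible : x < y → ℓ (swapPos w a b) + 2 * (toℕ b ∸ toℕ a) ≢ ℓ w + 1
    quantum-ascent-impossible x<y eq = <-irrefl (sym eq) (begin-strict
      ℓ w + 1                                 <⟨ m<m+n (ℓ w + 1) (*-monoʳ-< 2 0<b∸a) ⟩
      ℓ w + 1 + 2 * (toℕ b ∸ toℕ a)           ≤⟨ +-monoˡ-≤ (2 * (toℕ b ∸ toℕ a)) ℓ+1≤ℓ′ ⟩
      ℓ (swapPos w a b) + 2 * (toℕ b ∸ toℕ a) ∎)
      where
      open ≤-Reasoning
      0<b∸a = subst (0 <_) (sym b∸a≡1+∑inside) z<s
      ℓ+1≤ℓ′ = subst (ℓ w + 1 ≤_) (sym (ℓ-swapPos-ascent w w-inj x<y)) (m≤m+n (ℓ w + 1) _)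

    bruhat-descent-impossible : y < x → ℓ (swapPos w a b) ≢ ℓ w + 1
    bruhat-descent-impossible y<x ℓ′≡ℓ+1 = <-irrefl refl (begin-strict
      ℓ w                                                  <⟨ n<1+n (ℓ w) ⟩
      suc (ℓ w)                                            ≡⟨ +-comm 1 (ℓ w) ⟩
      ℓ w + 1                                              ≡⟨ ℓ′≡ℓ+1 ⟨
      ℓ (swapPos w a b)                                    <⟨ m<m+n (ℓ (swapPos w a b)) z<s ⟩
      ℓ (swapPos w a b) + 1                                ≤⟨ m≤m+n (ℓ (swapPos w a b) + 1) _ ⟩
      ℓ (swapPos w a b) + 1 + 2 * valuesBetween w y x      ≡⟨ ℓ-swapPos-descent w w-inj y<x ⟩
      ℓ w                                                  ∎)
      where open ≤-Reasoning

    quantum-descent⇔ : y < x → ℓ (swapPos w a b) + 2 * (toℕ b ∸ toℕ a) ≡ ℓ w + 1 ⇔ valuesBetween w y x ≡ S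
    quantum-descent⇔ y<x = mk⇔
      (λ eq → sym (*-cancelˡ-≡ S N 2 (+-cancelˡ-≡ (ℓ′ + 2) _ _ (begin
        ℓ′ + 2 + 2 * S                ≡⟨ lhs ⟨
        ℓ′ + 2 * (toℕ b ∸ toℕ a)      ≡⟨ eq ⟩
        ℓ w + 1                       ≡⟨ rhs ⟨
        ℓ′ + 2 + 2 * N                ∎))))
      (λ N≡S → begin
        ℓ′ + 2 * (toℕ b ∸ toℕ a)      ≡⟨ lhs ⟩
        ℓ′ + 2 + 2 * S                ≡⟨ cong (λ s → ℓ′ + 2 + 2 * s) N≡S ⟨
        ℓ′ + 2 + 2 * N                ≡⟨ rhs ⟩
        ℓ w + 1                       ∎)
      where
      open ≡-Reasoning
      ℓ′ = ℓ (swapPos w a b)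
      N = valuesBetween w y x
      lhs : ℓ′ + 2 * (toℕ b ∸ toℕ a) ≡ ℓ′ + 2 + 2 * S
      lhs = trans (cong (λ d → ℓ′ + 2 * d) b∸a≡1+∑inside) (twice ℓ′ S)
      rhs : ℓ′ + 2 + 2 * N ≡ ℓ w + 1
      rhs = trans (sym (shift ℓ′ N)) (cong (_+ 1) (ℓ-swapPos-descent w w-inj y<x))

    qbgEdge-ascent : x < y → QBGEdge w a b ⇔
      (∀ c → toℕ a < toℕ c → toℕ c < toℕ b → ¬ (x < toℕ (w c) × toℕ (w c) < y))
    qbgEdge-ascent x<y = mk⇔
      (λ { (_ , inj₁ bruhat)  → Equivalence.to valuesBetween≡0⇔ (Equivalence.to (bruhat-ascent⇔ x<y) bruhat)
         ; (_ , inj₂ quantum) → ⊥-elim (quantum-ascent-impossible x<y quantum) })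
      (λ none → a<b , inj₁ (Equivalence.from (bruhat-ascent⇔ x<y) (Equivalence.from valuesBetween≡0⇔ none)))

    qbgEdge-descent : y < x → QBGEdge w a b ⇔
      (∀ c → toℕ a < toℕ c → toℕ c < toℕ b → y < toℕ (w c) × toℕ (w c) < x)
    qbgEdge-descent y<x = mk⇔
      (λ { (_ , inj₁ bruhat)  → ⊥-elim (bruhat-descent-impossible y<x bruhat)
         ; (_ , inj₂ quantum) →
             Equivalence.to valuesBetween≡∑⇔ (Equivalence.to (quantum-descent⇔ y<x) quantum) })
      (λ all → a<b , inj₂ (Equivalence.from (quantum-descent⇔ y<x) (Equivalence.from valuesBetween≡∑⇔ all)))

-- Clock arithmetic

-- cyc on the underlying numbers: cyc x y is definitionally cycℕ n (toℕ x) (toℕ y).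
cycℕ : ℕ → ℕ → ℕ → ℕ
cycℕ n X Y = if X ≤ᵇ Y then Y ∸ X else (Y + n) ∸ X

CircBetweenℕ : ℕ → ℕ → ℕ → ℕ → Set
CircBetweenℕ n X Z Y = 0 < cycℕ n X Z × cycℕ n X Z < cycℕ n X Y

data Wrap (n : ℕ) : ℕ → Set where
  stay : Wrap n 0
  wrap : Wrap n n

-- d steps forward from X on a clock with n positions land on Y.
ClockSteps : ℕ → ℕ → ℕ → ℕ → Set
ClockSteps n X d Y = ∃ λ e → Wrap n e × d + X ≡ Y + e

module _ {n X Y : ℕ} where

  cycℕ-noWrap : X ≤ Y → cycℕ n X Y + X ≡ Y
  cycℕ-noWrap X≤Y rewrite Equivalence.to T-≡ (≤⇒≤ᵇ X≤Y) = m∸n+n≡m X≤Y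

  cycℕ-wrap : Y < X → X < n → cycℕ n X Y + X ≡ Y + n
  cycℕ-wrap Y<X X<n with X ≤ᵇ Y in X≤ᵇY
  ... | true  = ⊥-elim (<⇒≱ Y<X (≤ᵇ⇒≤ X Y (subst T (sym X≤ᵇY) _)))
  ... | false = m∸n+n≡m (≤-trans (<⇒≤ X<n) (m≤n+m n Y))

  cycℕ-clockSteps : X < n → ClockSteps n X (cycℕ n X Y) Y
  cycℕ-clockSteps X<n with X ≤? Y
  ... | yes X≤Y = 0 , stay , trans (cycℕ-noWrap X≤Y) (sym (+-identityʳ Y))
  ... | no X≰Y  = n , wrap , cycℕ-wrap (≰⇒> X≰Y) X<n

  cycℕ<n : X < n → Y < n → cycℕ n X Y < n
  cycℕ<n X<n Y<n with X ≤? Y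
  ... | yes X≤Y = ≤-<-trans (m≤m+n _ X) (subst (_< n) (sym (cycℕ-noWrap X≤Y)) Y<n)
  ... | no X≰Y  = +-cancelʳ-< X _ n (begin-strict
    cycℕ n X Y + X ≡⟨ cycℕ-wrap (≰⇒> X≰Y) X<n ⟩
    Y + n          <⟨ +-monoˡ-< n (≰⇒> X≰Y) ⟩
    X + n          ≡⟨ +-comm X n ⟩
    n + X          ∎)
    where open ≤-Reasoning

wrap-cancel : ∀ {n u v e e′} → u < n → v < n → Wrap n e → Wrap n e′ → u + e ≡ v + e′ → u ≡ v
wrap-cancel _ _ stay stay eq = +-cancelʳ-≡ 0 _ _ eq
wrap-cancel {n} _ _ wrap wrap eq = +-cancelʳ-≡ n _ _ eq
wrap-cancel {n} {u} {v} u<n _ stay wrap eq =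
  ⊥-elim (<⇒≱ u<n (≤-trans (m≤n+m n v) (≤-reflexive (trans (sym eq) (+-identityʳ u)))))
wrap-cancel {n} {u} {v} _ v<n wrap stay eq =
  ⊥-elim (<⇒≱ v<n (≤-trans (m≤n+m n u) (≤-reflexive (trans eq (+-identityʳ v)))))

clockSteps-unique : ∀ {n X Y d d′} → d < n → d′ < n → ClockSteps n X d Y → ClockSteps n X d′ Y → d ≡ d′
clockSteps-unique {n} {X} {Y} {d} {d′} d<n d′<n (e , wr , eq) (e′ , wr′ , eq′) =
  wrap-cancel d<n d′<n wr′ wr (+-cancelʳ-≡ X _ _ (begin
    d + e′ + X   ≡⟨ swap-last d e′ X ⟩
    d + X + e′   ≡⟨ cong (_+ e′) eq ⟩
    Y + e + e′   ≡⟨ swap-last Y e e′ ⟩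
    Y + e′ + e   ≡⟨ cong (_+ e) eq′ ⟨
    d′ + X + e   ≡⟨ swap-last d′ X e ⟩
    d′ + e + X   ∎))
  where
  open ≡-Reasoning
  swap-last : ∀ p q r → p + q + r ≡ p + r + q
  swap-last = solve-∀

clockSteps-target-unique : ∀ {n X Y Z d} → Y < n → Z < n → ClockSteps n X d Y → ClockSteps n X d Z → Y ≡ Z
clockSteps-target-unique Y<n Z<n (_ , wr , eq) (_ , wr′ , eq′) =
  wrap-cancel Y<n Z<n wr wr′ (trans (sym eq) eq′)

private
  realign : ∀ {n s t e₁ e₂ e₃} → s < n + n → t < n → Wrap n e₁ → Wrap n e₂ → Wrap n e₃ →
    s + e₃ ≡ t + e₁ + e₂ → ∃ λ e → Wrap n e × s ≡ t + e
  realign {s = s} {t} _ _ stay stay stay eq =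
    0 , stay , trans (sym (+-identityʳ s)) (trans eq (+-identityʳ (t + 0)))
  realign {n} {s} {t} _ _ wrap stay stay eq =
    n , wrap , trans (sym (+-identityʳ s)) (trans eq (+-identityʳ (t + n)))
  realign {n} {s} {t} _ _ stay wrap stay eq =
    n , wrap , trans (sym (+-identityʳ s)) (trans eq (cong (_+ n) (+-identityʳ t)))
  realign {n} {s} {t} s<2n _ wrap wrap stay eq =
    ⊥-elim (<⇒≱ s<2n (subst (n + n ≤_) (trans (sym eq) (+-identityʳ s))
                              (≤-trans (m≤n+m (n + n) t) (≤-reflexive (sym (+-assoc t n n))))))
  realign {n} {s} {t} _ t<n stay stay wrap eq =
    ⊥-elim (<⇒≱ t<n (subst (n ≤_) (trans eq (trans (+-identityʳ (t + 0)) (+-identityʳ t))) (m≤n+m n s)))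
  realign {n} {s} {t} _ _ wrap stay wrap eq =
    0 , stay , trans (+-cancelʳ-≡ n s t (trans eq (+-identityʳ (t + n)))) (sym (+-identityʳ t))
  realign {n} {s} {t} _ _ stay wrap wrap eq = 0 , stay , +-cancelʳ-≡ n s (t + 0) eq
  realign {n} {s} {t} _ _ wrap wrap wrap eq = n , wrap , +-cancelʳ-≡ n s (t + n) eq

cycℕ-rebase : ∀ {n A X Z} → A < n → X < n → Z < n → cycℕ n (cycℕ n A X) (cycℕ n A Z) ≡ cycℕ n X Z
cycℕ-rebase {n} {A} {X} {Z} A<n X<n Z<n
  with cycℕ-clockSteps {n} {A} {X} A<n | cycℕ-clockSteps {n} {A} {Z} A<n | cycℕ-clockSteps {n} {X} {Z} X<n
... | e₁ , wrap₁ , eq₁ | e₂ , wrap₂ , eq₂ | e , wrap₀ , eq =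
  clockSteps-unique (cycℕ<n d₁<n d₂<n) d<n (cycℕ-clockSteps d₁<n)
    (realign (+-mono-< d<n d₁<n) d₂<n wrap₀ wrap₁ wrap₂ (+-cancelʳ-≡ A _ _ (begin
      d + d₁ + e₂ + A    ≡⟨ regroup₁ d d₁ e₂ A ⟩
      d + (d₁ + A) + e₂  ≡⟨ cong (λ s → d + s + e₂) eq₁ ⟩
      d + (X + e₁) + e₂  ≡⟨ regroup₂ d X e₁ e₂ ⟩
      d + X + e₁ + e₂    ≡⟨ cong (λ s → s + e₁ + e₂) eq ⟩
      Z + e + e₁ + e₂    ≡⟨ regroup₃ Z e e₁ e₂ ⟩
      Z + e₂ + e + e₁    ≡⟨ cong (λ s → s + e + e₁) eq₂ ⟨
      d₂ + A + e + e₁    ≡⟨ regroup₄ d₂ A e e₁ ⟩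
      d₂ + e + e₁ + A    ∎)))
  where
  open ≡-Reasoning
  d₁ = cycℕ n A X
  d₂ = cycℕ n A Z
  d  = cycℕ n X Z
  d₁<n = cycℕ<n A<n X<n
  d₂<n = cycℕ<n A<n Z<n
  d<n  = cycℕ<n X<n Z<n
  regroup₁ : ∀ p q r s → p + q + r + s ≡ p + (q + s) + r
  regroup₁ = solve-∀
  regroup₂ : ∀ p q r s → p + (q + r) + s ≡ p + q + r + s
  regroup₂ = solve-∀
  regroup₃ : ∀ p q r s → p + q + r + s ≡ p + s + q + r
  regroup₃ = solve-∀
  regroup₄ : ∀ p q r s → p + q + r + s ≡ p + r + s + q
  regroup₄ = solve-∀

module _ {n X Y Z : ℕ} where

  private
    cancel-< : ∀ {d d′ P Q} → d + X ≡ P → d′ + X ≡ Q → P < Q → d < d′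
    cancel-< {d} {d′} d+X≡P d′+X≡Q = +-cancelʳ-< X d d′ ∘ subst₂ _<_ (sym d+X≡P) (sym d′+X≡Q)

    shift-< : ∀ {d d′ P Q} → d + X ≡ P → d′ + X ≡ Q → d < d′ → P < Q
    shift-< d+X≡P d′+X≡Q = subst₂ _<_ d+X≡P d′+X≡Q ∘ +-monoˡ-< X

  circBetweenℕ-ascending : X < Y → Y < n → CircBetweenℕ n X Z Y ⇔ (X < Z × Z < Y)
  circBetweenℕ-ascending X<Y Y<n with X ≤? Z
  ... | yes X≤Z = mk⇔
        (λ (0<dZ , dZ<dY) → shift-< refl dZ (0<dZ) , shift-< dZ dY dZ<dY)
        (λ (X<Z , Z<Y) → cancel-< refl dZ X<Z , cancel-< dZ dY Z<Y)
    where
    dZ = cycℕ-noWrap {n} X≤Z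
    dY = cycℕ-noWrap {n} (<⇒≤ X<Y)
  ... | no X≰Z = mk⇔
        (λ (_ , dZ<dY) → ⊥-elim (<-asym (shift-< dZ dY dZ<dY) (<-≤-trans Y<n (m≤n+m n Z))))
        (λ (X<Z , _) → ⊥-elim (X≰Z (<⇒≤ X<Z)))
    where
    dZ = cycℕ-wrap {n} (≰⇒> X≰Z) (<-trans X<Y Y<n)
    dY = cycℕ-noWrap {n} (<⇒≤ X<Y)

  circBetweenℕ-descending : Y < X → X < n → Z < n → CircBetweenℕ n X Z Y ⇔ (X < Z ⊎ Z < Y)
  circBetweenℕ-descending Y<X X<n Z<n with X ≤? Z
  ... | yes X≤Z = mk⇔
        (λ (0<dZ , _) → inj₁ (shift-< refl dZ 0<dZ))
        (λ { (inj₁ X<Z) → cancel-< refl dZ X<Z , cancel-< dZ dY (<-≤-trans Z<n (m≤n+m n Y))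
           ; (inj₂ Z<Y) → ⊥-elim (<⇒≱ (<-trans Z<Y Y<X) X≤Z) })
    where
    dZ = cycℕ-noWrap {n} X≤Z
    dY = cycℕ-wrap {n} Y<X X<n
  ... | no X≰Z = mk⇔
        (λ (_ , dZ<dY) → inj₂ (+-cancelʳ-< n Z Y (shift-< dZ dY dZ<dY)))
        (λ { (inj₁ X<Z) → ⊥-elim (X≰Z (<⇒≤ X<Z))
           ; (inj₂ Z<Y) → cancel-< refl dZ (<-≤-trans X<n (m≤n+m n Z)) , cancel-< dZ dY (+-monoˡ-< n Z<Y) })
    where
    dZ = cycℕ-wrap {n} (≰⇒> X≰Z) X<n
    dY = cycℕ-wrap {n} Y<X X<n

cyc-self : (x : Fin n) → cyc x x ≡ 0
cyc-self {n} x = +-cancelʳ-≡ (toℕ x) _ 0 (cycℕ-noWrap {n} (≤-refl {toℕ x}))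

cyc<n : (x y : Fin n) → cyc x y < n
cyc<n x y = cycℕ<n (toℕ<n x) (toℕ<n y)

cyc-injective : (x : Fin n) {y z : Fin n} → cyc x y ≡ cyc x z → y ≡ z
cyc-injective x {y} {z} eq = toℕ-injective (clockSteps-target-unique {d = cyc x y} (toℕ<n y) (toℕ<n z)
  (cycℕ-clockSteps (toℕ<n x))
  (subst (λ d → ClockSteps _ (toℕ x) d (toℕ z)) (sym eq) (cycℕ-clockSteps (toℕ<n x))))

cyc-rebase : (x₀ x z : Fin n) → cyc x z ≡ cycℕ n (cyc x₀ x) (cyc x₀ z)
cyc-rebase x₀ x z = sym (cycℕ-rebase (toℕ<n x₀) (toℕ<n x) (toℕ<n z))

-- The quantum Bruhat criterion

qbgEdge⇔noCircBetween : {w : Fin n → Fin n} {a b : Fin n} → Injective _≡_ _≡_ w → toℕ a < toℕ b →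
  QBGEdge w a b ⇔ (∀ c → toℕ a < toℕ c → toℕ c < toℕ b → ¬ CircBetween (w a) (w c) (w b))
qbgEdge⇔noCircBetween {n} {w} {a} {b} w-inj a<b with <-cmp (toℕ (w a)) (toℕ (w b))
... | tri< x<y _ _ = mk⇔
      (λ edge c a<c c<b → Equivalence.to ascent edge c a<c c<b ∘ Equivalence.to (between c))
      (λ none → Equivalence.from ascent (λ c a<c c<b → none c a<c c<b ∘ Equivalence.from (between c)))
  where
  ascent = TranspositionLength.qbgEdge-ascent a b a<b w-inj x<y
  between : ∀ c → CircBetween (w a) (w c) (w b) ⇔ (toℕ (w a) < toℕ (w c) × toℕ (w c) < toℕ (w b))
  between c = circBetweenℕ-ascending x<y (toℕ<n (w b))
... | tri≈ _ x≡y _ = ⊥-elim (Fin.<⇒≢ a<b (w-inj (toℕ-injective x≡y)))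
... | tri> _ _ y<x = mk⇔
      (λ edge c a<c c<b circ → [ (λ x<v → <-asym x<v (proj₂ (Equivalence.to descent edge c a<c c<b)))
                                , (λ v<y → <-asym v<y (proj₁ (Equivalence.to descent edge c a<c c<b))) ]′
                                (Equivalence.to (between c) circ))
      (λ none → Equivalence.from descent (λ c a<c c<b →
        let v≰x = none c a<c c<b ∘ Equivalence.from (between c) ∘ inj₁
            y≰v = none c a<c c<b ∘ Equivalence.from (between c) ∘ inj₂
        in  ≤∧≢⇒< (≮⇒≥ y≰v) (value≢ (≢-sym (Fin.<⇒≢ c<b))) ,
            ≤∧≢⇒< (≮⇒≥ v≰x) (value≢ (≢-sym (Fin.<⇒≢ a<c)))))
  where
  descent = TranspositionLength.qbgEdge-descent a b a<b w-inj y<x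
  between : ∀ c → CircBetween (w a) (w c) (w b) ⇔ (toℕ (w a) < toℕ (w c) ⊎ toℕ (w c) < toℕ (w b))
  between c = circBetweenℕ-descending y<x (toℕ<n (w a)) (toℕ<n (w c))
  value≢ : ∀ {c d} → c ≢ d → toℕ (w c) ≢ toℕ (w d)
  value≢ c≢d = c≢d ∘ w-inj ∘ toℕ-injective

module CircularOrderFrom {n : ℕ} (x₀ : Fin n) where

  rank : Fin n → ℕ
  rank = cyc x₀

  rank-origin : rank x₀ ≡ 0
  rank-origin = cyc-self x₀

  rank-injective : ∀ {x y} → rank x ≡ rank y → x ≡ y
  rank-injective = cyc-injective x₀

  rank-positive : ∀ {x} → x ≢ x₀ → 0 < rank x
  rank-positive x≢x₀ = n≢0⇒n>0 (x≢x₀ ∘ rank-injective ∘ flip trans (sym rank-origin))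

  circBetween⇔rank : ∀ {x y z} → rank x < rank y → CircBetween x z y ⇔ (rank x < rank z × rank z < rank y)
  circBetween⇔rank {x} {y} {z} rx<ry =
    subst₂ (λ p q → (0 < p × p < q) ⇔ (rank x < rank z × rank z < rank y))
           (sym (cyc-rebase x₀ x z)) (sym (cyc-rebase x₀ x y))
           (circBetweenℕ-ascending rx<ry (cyc<n x₀ y))

  origin-circBetween : ∀ {x y} → rank y < rank x → 0 < rank y → CircBetween x x₀ y
  origin-circBetween {x} {y} ry<rx 0<ry =
    subst₂ (λ p q → 0 < p × p < q) (sym (cyc-rebase x₀ x x₀)) (sym (cyc-rebase x₀ x y))
           (Equivalence.from (circBetweenℕ-descending ry<rx (cyc<n x₀ x) (cyc<n x₀ x₀))
                             (inj₂ (subst (_< rank y) (sym rank-origin) 0<ry)))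

  module _ {w : Fin n → Fin n} (w-inj : Injective _≡_ _≡_ w) where

    qbgEdge⇔rank : ∀ {a b} → toℕ a < toℕ b → rank (w a) < rank (w b) → QBGEdge w a b ⇔
      (∀ c → toℕ a < toℕ c → toℕ c < toℕ b → ¬ (rank (w a) < rank (w c) × rank (w c) < rank (w b)))
    qbgEdge⇔rank a<b ra<rb = mk⇔
      (λ edge c a<c c<b → Equivalence.to criterion edge c a<c c<b ∘ Equivalence.from (circBetween⇔rank ra<rb))
      (λ none → Equivalence.from criterion
                  (λ c a<c c<b → none c a<c c<b ∘ Equivalence.to (circBetween⇔rank ra<rb)))
      where criterion = qbgEdge⇔noCircBetween w-inj a<b

    qbgEdge-origin-inside : ∀ {a b c} → QBGEdge w a b → toℕ a < toℕ c → toℕ c < toℕ b → w c ≡ x₀ →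
      rank (w a) < rank (w b)
    qbgEdge-origin-inside {a} {b} {c} edge@(a<b , _) a<c c<b wc≡x₀ with <-cmp (rank (w a)) (rank (w b))
    ... | tri< ra<rb _ _ = ra<rb
    ... | tri≈ _ ra≡rb _ = ⊥-elim (Fin.<⇒≢ a<b (w-inj (rank-injective ra≡rb)))
    ... | tri> _ _ rb<ra = ⊥-elim (Equivalence.to (qbgEdge⇔noCircBetween w-inj a<b) edge c a<c c<b
          (subst (λ v → CircBetween (w a) v (w b)) (sym wc≡x₀) (origin-circBetween rb<ra 0<rb)))
      where
      0<rb : 0 < rank (w b)
      0<rb = rank-positive (λ wb≡x₀ → Fin.<⇒≢ c<b (w-inj (trans wc≡x₀ (sym wb≡x₀))))

-- Paths with labels (I, m₁), (I, m₂), …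

module RowPaths {n : ℕ} (I x₀ : Fin n) where

  open CircularOrderFrom x₀

  Ascending : List (Fin n) → Set
  Ascending = Linked (λ p q → toℕ p < toℕ q)

  RowPath : (Fin n → Fin n) → List (Fin n) → Set
  RowPath w ms = All (λ m → toℕ I < toℕ m) ms × Ascending ms × QBGPath w I ms

  OriginBelow : (Fin n → Fin n) → ℕ → Set
  OriginBelow w s = ∃ λ c → toℕ I ≤ toℕ c × toℕ c < s × w c ≡ x₀

  originBelow-mono : ∀ {w s s′} → s ≤ s′ → OriginBelow w s → OriginBelow w s′
  originBelow-mono s≤s′ (c , I≤c , c<s , wc≡x₀) = c , I≤c , <-≤-trans c<s s≤s′ , wc≡x₀

  originBelow-swap : ∀ {w m} → toℕ I < toℕ m → OriginBelow w (toℕ m) →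
    OriginBelow (swapPos w I m) (suc (toℕ m))
  originBelow-swap {w} {m} I<m (c , I≤c , c<m , wc≡x₀) with m≤n⇒m<n∨m≡n I≤c
  ... | inj₂ I≡c = m , <⇒≤ I<m , n<1+n (toℕ m) ,
                   trans (swapPos-matchʳ I m w) (trans (cong w (toℕ-injective I≡c)) wc≡x₀)
  ... | inj₁ I<c = c , I≤c , m<n⇒m<1+n c<m ,
                   trans (swapPos-other I m w (≢-sym (Fin.<⇒≢ I<c)) (Fin.<⇒≢ c<m)) wc≡x₀

  step-ascends : ∀ {w m} → Injective _≡_ _≡_ w → QBGEdge w I m → OriginBelow w (toℕ m) →
    rank (w I) < rank (w m)
  step-ascends {w} {m} w-inj edge@(I<m , _) (c , I≤c , c<m , wc≡x₀) with m≤n⇒m<n∨m≡n I≤c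
  ... | inj₁ I<c = qbgEdge-origin-inside w-inj edge I<c c<m wc≡x₀
  ... | inj₂ I≡c = subst (_< rank (w m)) (sym (trans (cong rank wI≡x₀) rank-origin))
                     (rank-positive (λ wm≡x₀ → Fin.<⇒≢ I<m (w-inj (trans wI≡x₀ (sym wm≡x₀)))))
    where
    wI≡x₀ : w I ≡ x₀
    wI≡x₀ = trans (cong w (toℕ-injective I≡c)) wc≡x₀

  ascending-beyond : ∀ {m ms} → Ascending (m ∷ ms) → All (λ t → toℕ m < toℕ t) ms
  ascending-beyond [-]          = []
  ascending-beyond (m<t ∷ asc) = Linked⇒All <-trans m<t asc

  swapPos-beyond : ∀ w {m c} → toℕ I < toℕ m → toℕ m < toℕ c → swapPos w I m c ≡ w c
  swapPos-beyond w {m} I<m m<c =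
    swapPos-other I m w (≢-sym (Fin.<⇒≢ (<-trans I<m m<c))) (≢-sym (Fin.<⇒≢ m<c))

  rowPath-chain : ∀ {w m ms} → Injective _≡_ _≡_ w → RowPath w (m ∷ ms) → OriginBelow w (toℕ m) →
    Linked (λ s t → rank s < rank t) (map w (I ∷ m ∷ ms))
  rowPath-chain {w} {m} {[]} w-inj (_ , _ , edge , _) origin = step-ascends w-inj edge origin ∷ [-]
  rowPath-chain {w} {m} {m′ ∷ ms} w-inj (I<m ∷ I<ms , m<m′ ∷ asc , edge , path) origin =
    step-ascends w-inj edge origin ∷ subst₂ (λ h t → Linked (λ s t → rank s < rank t) (h ∷ t))
      (swapPos-matchˡ I m w)
      (map-cong-local (All.map (swapPos-beyond w I<m) (ascending-beyond (m<m′ ∷ asc))))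
      (rowPath-chain (swapPos-injective I m w w-inj) (I<ms , asc , path)
                     (originBelow-mono m<m′ (originBelow-swap I<m origin)))

  rowPath-gap : ∀ {w m ms p} → Injective _≡_ _≡_ w → RowPath w (m ∷ ms) → OriginBelow w (toℕ m) →
    last (m ∷ ms) ≡ just p → ∀ c → toℕ I < toℕ c → toℕ c < toℕ m →
    ¬ (rank (w I) < rank (w c) × rank (w c) < rank (w p))
  rowPath-gap {w} {m} {[]} w-inj (I<m ∷ _ , _ , edge , _) origin last≡p c I<c c<m =
    subst (λ q → ¬ (rank (w I) < rank (w c) × rank (w c) < rank (w q))) (just-injective last≡p)
          (Equivalence.to (qbgEdge⇔rank w-inj I<m (step-ascends w-inj edge origin)) edge c I<c c<m)
  rowPath-gap {w} {m} {m′ ∷ ms} {p} w-inj (I<m ∷ I<ms , m<m′ ∷ asc , edge , path) origin last≡p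
              c I<c c<m (rI<rc , rc<rp) with <-cmp (rank (w c)) (rank (w m))
  ... | tri< rc<rm _ _ = Equivalence.to (qbgEdge⇔rank w-inj I<m (step-ascends w-inj edge origin))
                                        edge c I<c c<m (rI<rc , rc<rm)
  ... | tri≈ _ rc≡rm _ = Fin.<⇒≢ c<m (w-inj (rank-injective rc≡rm))
  ... | tri> _ _ rm<rc =
        rowPath-gap (swapPos-injective I m w w-inj) (I<ms , asc , path)
          (originBelow-mono m<m′ (originBelow-swap I<m origin)) last≡p c I<c (<-trans c<m m<m′)
          (subst₂ (λ s t → rank s < rank t) (sym (swapPos-matchˡ I m w)) (sym w′c≡wc) rm<rc ,
           subst₂ (λ s t → rank s < rank t) (sym w′c≡wc) (sym (swapPos-beyond w I<m m<p)) rc<rp)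
    where
    w′c≡wc : swapPos w I m c ≡ w c
    w′c≡wc = swapPos-other I m w (≢-sym (Fin.<⇒≢ I<c)) (Fin.<⇒≢ c<m)
    m<p : toℕ m < toℕ p
    m<p = linked-last⁺ <-trans (m<m′ ∷ asc) last≡p

  rowPath-tail : ∀ {w m ms} → RowPath w (m ∷ ms) → RowPath (swapPos w I m) ms
  rowPath-tail (_ ∷ I<ms , asc , _ , path) = I<ms , Linked.tail asc , path

  module Towards (z : Fin n) where

    EndsAt : (Fin n → Fin n) → List (Fin n) → Set
    EndsAt w ms = ∃ λ p → last ms ≡ just p × w p ≡ z

    -- Candidates for the next step from w: later positions whose value lies in the
    -- circular interval (w(I), z].
    Ahead : (Fin n → Fin n) → Fin n → Set
    Ahead w c = toℕ I < toℕ c × rank (w I) < rank (w c) × rank (w c) ≤ rank z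

    ahead? : ∀ w c → Dec (Ahead w c)
    ahead? w c = toℕ I <? toℕ c ×-dec rank (w I) <? rank (w c) ×-dec rank (w c) ≤? rank z

    route-head-least : ∀ {w m ms} → Injective _≡_ _≡_ w → RowPath w (m ∷ ms) → EndsAt w (m ∷ ms) →
      OriginBelow w (toℕ m) → Ahead w m × (∀ c → toℕ c < toℕ m → ¬ Ahead w c)
    route-head-least {w} {m} {ms} w-inj rp@(I<m ∷ _ , asc , edge , _) (p , last≡p , wp≡z) origin =
      (I<m , step-ascends w-inj edge origin , rm≤rz) , not-ahead
      where
      rp≡rz : rank (w p) ≡ rank z
      rp≡rz = cong rank wp≡z
      rm≤rz : rank (w m) ≤ rank z
      rm≤rz with linked-last <-trans (Linked.tail (rowPath-chain w-inj rp origin))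
                                     (trans (last-map w (m ∷ ms)) (cong (Maybe.map w) last≡p))
      ... | inj₁ wm≡wp = ≤-reflexive (trans (cong rank wm≡wp) rp≡rz)
      ... | inj₂ rm<rp = <⇒≤ (subst (rank (w m) <_) rp≡rz rm<rp)
      not-ahead : ∀ c → toℕ c < toℕ m → ¬ Ahead w c
      not-ahead c c<m (I<c , rI<rc , rc≤rz) with m≤n⇒m<n∨m≡n rc≤rz
      ... | inj₁ rc<rz =
        rowPath-gap w-inj rp origin last≡p c I<c c<m (rI<rc , subst (rank (w c) <_) (sym rp≡rz) rc<rz)
      ... | inj₂ rc≡rz = <⇒≱ c<m (subst (λ q → toℕ m ≤ toℕ q)
              (w-inj (rank-injective (trans rp≡rz (sym rc≡rz))))
              ([ ≤-reflexive ∘ cong toℕ , <⇒≤ ]′ (linked-last <-trans asc last≡p)))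

    endsAt-tail : ∀ {w m m′ ms} → toℕ I < toℕ m → Ascending (m ∷ m′ ∷ ms) → EndsAt w (m ∷ m′ ∷ ms) →
      EndsAt (swapPos w I m) (m′ ∷ ms)
    endsAt-tail {w} I<m asc (p , last≡p , wp≡z) =
      p , last≡p , trans (swapPos-beyond w I<m (linked-last⁺ <-trans asc last≡p)) wp≡z

    route-stops-at-target : ∀ {w m m′ ms} → Injective _≡_ _≡_ w → w m ≡ z → RowPath w (m ∷ m′ ∷ ms) →
      EndsAt w (m ∷ m′ ∷ ms) → OriginBelow w (toℕ m) → ⊥
    route-stops-at-target {w} {m} {m′} w-inj wm≡z rp@(I<m ∷ _ , asc@(m<m′ ∷ _) , _) ends origin
      with route-head-least (swapPos-injective I m w w-inj) (rowPath-tail {w} rp)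
                            (endsAt-tail {w} I<m asc ends)
             (originBelow-mono m<m′ (originBelow-swap I<m origin))
    ... | (_ , rw′I<rw′m′ , rw′m′≤rz) , _ = <-irrefl refl (begin-strict
      rank z                      ≡⟨ cong rank (trans (sym wm≡z) (sym (swapPos-matchˡ I m w))) ⟩
      rank (swapPos w I m I)      <⟨ rw′I<rw′m′ ⟩
      rank (swapPos w I m m′)     ≤⟨ rw′m′≤rz ⟩
      rank z                      ∎)
      where open ≤-Reasoning

    route-heads-agree : ∀ {w m m′ ms ms′} → Injective _≡_ _≡_ w →
      RowPath w (m ∷ ms) → EndsAt w (m ∷ ms) → OriginBelow w (toℕ m) →
      RowPath w (m′ ∷ ms′) → EndsAt w (m′ ∷ ms′) → OriginBelow w (toℕ m′) → m ≡ m′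
    route-heads-agree {m = m} {m′} w-inj rp ends origin rp′ ends′ origin′ = by-cases (<-cmp (toℕ m) (toℕ m′))
      where
      least  = route-head-least w-inj rp ends origin
      least′ = route-head-least w-inj rp′ ends′ origin′
      by-cases : Tri (toℕ m < toℕ m′) (toℕ m ≡ toℕ m′) (toℕ m′ < toℕ m) → m ≡ m′
      by-cases (tri< m<m′ _ _) = ⊥-elim (proj₂ least′ m m<m′ (proj₁ least))
      by-cases (tri≈ _ m≡m′ _) = toℕ-injective m≡m′
      by-cases (tri> _ _ m′<m) = ⊥-elim (proj₂ least m′ m′<m (proj₁ least′))

    route-unique : ∀ {w s} → Injective _≡_ _≡_ w → OriginBelow w s → ∀ ms ms′ →
      RowPath w ms → EndsAt w ms → All (λ m → s ≤ toℕ m) ms →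
      RowPath w ms′ → EndsAt w ms′ → All (λ m → s ≤ toℕ m) ms′ → ms ≡ ms′
    route-unique _ _ [] _ _ (_ , () , _) _ _ _ _
    route-unique _ _ (_ ∷ _) [] _ _ _ _ (_ , () , _) _
    route-unique {w} w-inj origin (m ∷ ms) (m′ ∷ ms′) rp ends (s≤m ∷ _) rp′ ends′ (s≤m′ ∷ _)
      with route-heads-agree w-inj rp ends (originBelow-mono s≤m origin)
                                   rp′ ends′ (originBelow-mono s≤m′ origin)
    ... | refl = cong (m ∷_) (tails ms ms′ rp ends rp′ ends′)
      where
      I<m : toℕ I < toℕ m
      I<m = All.head (proj₁ rp)
      originₘ : OriginBelow w (toℕ m)
      originₘ = originBelow-mono s≤m origin
      tails : ∀ ts ts′ → RowPath w (m ∷ ts) → EndsAt w (m ∷ ts) →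
              RowPath w (m ∷ ts′) → EndsAt w (m ∷ ts′) → ts ≡ ts′
      tails [] [] _ _ _ _ = refl
      tails [] (_ ∷ _) _ (_ , last≡p , wp≡z) rp′ ends′ =
        ⊥-elim (route-stops-at-target w-inj (trans (cong w (just-injective last≡p)) wp≡z) rp′ ends′ originₘ)
      tails (_ ∷ _) [] rp ends _ (_ , last≡p , wp≡z) =
        ⊥-elim (route-stops-at-target w-inj (trans (cong w (just-injective last≡p)) wp≡z) rp ends originₘ)
      tails (t ∷ ts) (t′ ∷ ts′) rp ends rp′ ends′ =
        route-unique (swapPos-injective I m w w-inj) (originBelow-swap I<m originₘ) (t ∷ ts) (t′ ∷ ts′)
          (rowPath-tail {w} rp) (endsAt-tail {w} I<m (proj₁ (proj₂ rp)) ends)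
          (ascending-beyond (proj₁ (proj₂ rp)))
          (rowPath-tail {w} rp′) (endsAt-tail {w} I<m (proj₁ (proj₂ rp′)) ends′)
          (ascending-beyond (proj₁ (proj₂ rp′)))

    first-ahead-edge : ∀ {w m} → Injective _≡_ _≡_ w → Ahead w m → (∀ c → toℕ c < toℕ m → ¬ Ahead w c) →
      QBGEdge w I m
    first-ahead-edge w-inj (I<m , rI<rm , rm≤rz) none-before = Equivalence.from (qbgEdge⇔rank w-inj I<m rI<rm)
      (λ c I<c c<m (rI<rc , rc<rm) → none-before c c<m (I<c , rI<rc , <⇒≤ (<-≤-trans rc<rm rm≤rz)))

    none-ahead-after-step : ∀ {w m} → Ahead w m → (∀ c → toℕ c < toℕ m → ¬ Ahead w c) →
      ∀ c → toℕ c < suc (toℕ m) → ¬ Ahead (swapPos w I m) c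
    none-ahead-after-step {w} {m} (I<m , rI<rm , _) none-before c c<1+m (I<c , rw′I<rw′c , rw′c≤rz)
      with m≤n⇒m<n∨m≡n (s≤s⁻¹ c<1+m)
    ... | inj₂ c≡m = <-asym rI<rm (subst₂ _<_ rw′I≡rwm
                       (cong rank (trans (cong (swapPos w I m) (toℕ-injective c≡m)) (swapPos-matchʳ I m w)))
                       rw′I<rw′c)
      where rw′I≡rwm = cong rank (swapPos-matchˡ I m w)
    ... | inj₁ c<m = none-before c c<m
                       (I<c , <-trans rI<rm (subst₂ _<_ rw′I≡rwm (cong rank w′c≡wc) rw′I<rw′c) ,
                        subst (_≤ rank z) (cong rank w′c≡wc) rw′c≤rz)
      where
      rw′I≡rwm = cong rank (swapPos-matchˡ I m w)
      w′c≡wc : swapPos w I m c ≡ w c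
      w′c≡wc = swapPos-other I m w (≢-sym (Fin.<⇒≢ I<c)) (Fin.<⇒≢ c<m)

    -- Greedy construction; every step moves rank (w I) strictly towards rank z, which bounds the fuel.
    route-exists : ∀ {w M} fuel s → Injective _≡_ _≡_ w → rank z ≤ rank (w I) + fuel →
      (∀ c → toℕ c < s → ¬ Ahead w c) → Ahead w M → w M ≡ z →
      ∃ λ ms → RowPath w ms × EndsAt w ms × All (λ m → s ≤ toℕ m) ms
    route-exists {w} zero _ _ rz≤rI+0 _ (_ , rI<rM , _) wM≡z =
      ⊥-elim (<⇒≱ (subst (rank (w I) <_) (cong rank wM≡z) rI<rM) (subst (rank z ≤_) (+-identityʳ _) rz≤rI+0))
    route-exists {w} {M} (suc fuel) s w-inj rz≤rI+fuel none-below aheadM@(I<M , _) wM≡z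
      with least-witness (ahead? w) aheadM
    ... | m , aheadₘ@(I<m , rI<rm , rm≤rz) , none-before = continue (m≤n⇒m<n∨m≡n rm≤rz)
      where
      s≤m : s ≤ toℕ m
      s≤m = ≮⇒≥ (λ m<s → none-below m m<s aheadₘ)
      edge : QBGEdge w I m
      edge = first-ahead-edge w-inj aheadₘ none-before
      continue : rank (w m) < rank z ⊎ rank (w m) ≡ rank z →
        ∃ λ ms → RowPath w ms × EndsAt w ms × All (λ t → s ≤ toℕ t) ms
      continue (inj₂ rm≡rz) =
        m ∷ [] , (I<m ∷ [] , [-] , edge , _) , (m , refl , rank-injective rm≡rz) , s≤m ∷ []
      continue (inj₁ rm<rz) = extend (route-exists fuel (suc (toℕ m)) (swapPos-injective I m w w-inj)
        fuel′ (none-ahead-after-step aheadₘ none-before) aheadM′ (trans w′M≡wM wM≡z))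
        where
        w′ : Fin n → Fin n
        w′ = swapPos w I m
        rw′I≡rwm : rank (w′ I) ≡ rank (w m)
        rw′I≡rwm = cong rank (swapPos-matchˡ I m w)
        m<M : toℕ m < toℕ M
        m<M = ≤∧≢⇒< (≮⇒≥ (λ M<m → none-before M M<m aheadM))
                    (λ m≡M → <-irrefl (trans (cong (rank ∘ w) (toℕ-injective m≡M)) (cong rank wM≡z)) rm<rz)
        w′M≡wM : w′ M ≡ w M
        w′M≡wM = swapPos-beyond w I<m m<M
        aheadM′ : Ahead w′ M
        aheadM′ = I<M , subst₂ _<_ (sym rw′I≡rwm) (cong rank (sym (trans w′M≡wM wM≡z))) rm<rz ,
                  ≤-reflexive (cong rank (trans w′M≡wM wM≡z))
        fuel′ : rank z ≤ rank (w′ I) + fuel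
        fuel′ = ≤-trans rz≤rI+fuel (≤-trans (≤-reflexive (+-suc (rank (w I)) fuel))
                  (+-monoˡ-≤ fuel (subst (suc (rank (w I)) ≤_) (sym rw′I≡rwm) rI<rm)))
        extend : (∃ λ ms → RowPath w′ ms × EndsAt w′ ms × All (λ t → suc (toℕ m) ≤ toℕ t) ms) →
                 ∃ λ ms → RowPath w ms × EndsAt w ms × All (λ t → s ≤ toℕ t) ms
        extend ([] , _ , (_ , () , _) , _)
        extend (t ∷ ts , (I<ts , asc , path) , (p , last≡p , w′p≡z) , bound@(m<t ∷ _)) =
          m ∷ t ∷ ts , (I<m ∷ I<ts , m<t ∷ asc , edge , path) ,
          (p , last≡p , trans (sym (swapPos-beyond w I<m (all-last bound last≡p))) w′p≡z) ,
          s≤m ∷ All.map (λ m<u → ≤-trans s≤m (<⇒≤ m<u)) bound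

module ColumnEntry {n k : ℕ} (u : Fin n → Fin n) (u-inj : Injective _≡_ _≡_ u)
  (C : Fin k → Fin n) (C-inj : Injective _≡_ _≡_ C) (k≤n : k ≤ n) (i : Fin k)
  (C≡u : ∀ (l : Fin k) → toℕ i < toℕ l → C l ≡ u (inject≤ l k≤n)) where

  I : Fin n
  I = inject≤ i k≤n

  open CircularOrderFrom (u I)
  open RowPaths I (u I)
  open Towards (C i)

  private
    toℕI≡i : toℕ I ≡ toℕ i
    toℕI≡i = toℕ-inject≤ i k≤n

    I<k : toℕ I < k
    I<k = subst (_< k) (sym toℕI≡i) (toℕ<n i)

    origin : ∀ {s} → toℕ I < s → OriginBelow u s
    origin I<s = I , ≤-refl , I<s , refl

    column-entry : ∀ c → toℕ I < toℕ c → toℕ c < k → ∃ λ l → toℕ i < toℕ l × C l ≡ u c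
    column-entry c I<c c<k =
      l , i<l , trans (C≡u l i<l) (cong u (toℕ-injective (trans (toℕ-inject≤ l k≤n) (toℕ-fromℕ< c<k))))
      where
      l = fromℕ< c<k
      i<l = subst₂ _<_ toℕI≡i (sym (toℕ-fromℕ< c<k)) I<c

    goodSeq⇒route : ∀ {ms} → GoodSeq u C k≤n i ms → RowPath u ms × EndsAt u ms
    goodSeq⇒route (k≤ms , asc , path , ends) = (All.map (<-≤-trans I<k) k≤ms , asc , path) , ends

  conditions-necessary : ∀ ms → GoodSeq u C k≤n i ms →
    (∀ (l : Fin n) → toℕ l < toℕ i → C i ≢ u l) ×
    (∀ (l : Fin k) → toℕ i < toℕ l → ¬ CircBetween (u I) (C l) (C i))
  conditions-necessary [] (_ , _ , _ , _ , () , _)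
  conditions-necessary (m ∷ ms) good@(k≤m ∷ _ , _ , _ , p , last≡p , up≡Ci) = earlier-values , gap
    where
    rp = proj₁ (goodSeq⇒route good)
    k≤p : k ≤ toℕ p
    k≤p = all-last (proj₁ good) last≡p
    earlier-values : ∀ (l : Fin n) → toℕ l < toℕ i → C i ≢ u l
    earlier-values l l<i Ci≡ul =
      Fin.<⇒≢ (<-trans l<i (<-≤-trans (toℕ<n i) k≤p)) (sym (u-inj (trans up≡Ci Ci≡ul)))
    gap : ∀ (l : Fin k) → toℕ i < toℕ l → ¬ CircBetween (u I) (C l) (C i)
    gap l i<l (0<rCl , rCl<rCi) = rowPath-gap u-inj rp (origin (<-≤-trans I<k k≤m)) last≡p
      (inject≤ l k≤n) (subst₂ _<_ (sym toℕI≡i) (sym (toℕ-inject≤ l k≤n)) i<l)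
      (subst (_< toℕ m) (sym (toℕ-inject≤ l k≤n)) (<-≤-trans (toℕ<n l) k≤m))
      (subst₂ _<_ (sym rank-origin) (cong rank (C≡u l i<l)) 0<rCl ,
       subst₂ _<_ (cong rank (C≡u l i<l)) (cong rank (sym up≡Ci)) rCl<rCi)

  conditions-sufficient : u I ≢ C i →
    (∀ (l : Fin n) → toℕ l < toℕ i → C i ≢ u l) →
    (∀ (l : Fin k) → toℕ i < toℕ l → ¬ CircBetween (u I) (C l) (C i)) →
    ∃ λ ms → (GoodSeq u C k≤n i ms × CircChain (u I) (map u ms)) ×
             ((ms′ : List (Fin n)) → GoodSeq u C k≤n i ms′ → ms′ ≡ ms)
  conditions-sufficient uI≢Ci earlier-values gap =
    package (route-exists (rank (C i)) k u-inj (m≤n+m (rank (C i)) (rank (u I))) none-ahead aheadM uM≡Ci)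
    where
    M : Fin n
    M = proj₁ (injective⇒surjective u-inj (C i))
    uM≡Ci : u M ≡ C i
    uM≡Ci = proj₂ (injective⇒surjective u-inj (C i))
    I<M : toℕ I < toℕ M
    I<M with <-cmp (toℕ I) (toℕ M)
    ... | tri< I<M _ _ = I<M
    ... | tri≈ _ I≡M _ = ⊥-elim (uI≢Ci (trans (cong u (toℕ-injective I≡M)) uM≡Ci))
    ... | tri> _ _ M<I = ⊥-elim (earlier-values M (subst (toℕ M <_) toℕI≡i M<I) (sym uM≡Ci))
    0<rCi : 0 < rank (C i)
    0<rCi = rank-positive (uI≢Ci ∘ sym)
    aheadM : Ahead u M
    aheadM = I<M , subst₂ _<_ (sym rank-origin) (cong rank (sym uM≡Ci)) 0<rCi , ≤-reflexive (cong rank uM≡Ci)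
    none-ahead : ∀ c → toℕ c < k → ¬ Ahead u c
    none-ahead c c<k (I<c , rI<rc , rc≤rCi) with column-entry c I<c c<k | m≤n⇒m<n∨m≡n rc≤rCi
    ... | l , i<l , Cl≡uc | inj₁ rc<rCi = gap l i<l (subst₂ _<_ rank-origin (cong rank (sym Cl≡uc)) rI<rc ,
                                                     subst (_< rank (C i)) (cong rank (sym Cl≡uc)) rc<rCi)
    ... | l , i<l , Cl≡uc | inj₂ rc≡rCi = Fin.<⇒≢ i<l (sym (C-inj (trans Cl≡uc (rank-injective rc≡rCi))))
    package : (∃ λ ms → RowPath u ms × EndsAt u ms × All (λ m → k ≤ toℕ m) ms) →
      ∃ λ ms → (GoodSeq u C k≤n i ms × CircChain (u I) (map u ms)) ×
               ((ms′ : List (Fin n)) → GoodSeq u C k≤n i ms′ → ms′ ≡ ms)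
    package ([] , _ , (_ , () , _) , _)
    package (m ∷ ms , rp@(I<m ∷ _ , asc , path) , ends , k≤ms) =
      m ∷ ms , ((k≤ms , asc , path , ends) , rowPath-chain u-inj rp (origin I<m)) ,
      λ ms′ good′ → route-unique u-inj (origin I<k) ms′ (m ∷ ms)
        (proj₁ (goodSeq⇒route good′)) (proj₂ (goodSeq⇒route good′)) (proj₁ good′) rp ends k≤ms

lemma4p8 : {n k : ℕ} (u : Fin n → Fin n) → Injective _≡_ _≡_ u
    → (C : Fin k → Fin n) → Injective _≡_ _≡_ C → (k≤n : k ℕ.≤ n)
    → (i : Fin k)
    → (∀ (l : Fin k) → toℕ i ℕ.< toℕ l → C l ≡ u (inject≤ l k≤n))
    → ((ms : List (Fin n)) → GoodSeq u C k≤n i ms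
        → (∀ (l : Fin n) → toℕ l ℕ.< toℕ i → C i ≢ u l)
          × (∀ (l : Fin k) → toℕ i ℕ.< toℕ l → ¬ CircBetween (u (inject≤ i k≤n)) (C l) (C i)))
      × (u (inject≤ i k≤n) ≢ C i
        → (∀ (l : Fin n) → toℕ l ℕ.< toℕ i → C i ≢ u l)
        → (∀ (l : Fin k) → toℕ i ℕ.< toℕ l → ¬ CircBetween (u (inject≤ i k≤n)) (C l) (C i))
        → ∃ (λ ms → (GoodSeq u C k≤n i ms × CircChain (u (inject≤ i k≤n)) (map u ms))
                    × ((ms′ : List (Fin n)) → GoodSeq u C k≤n i ms′ → ms′ ≡ ms)))
lemma4p8 u u-inj C C-inj k≤n i C≡u = conditions-necessary , conditions-sufficient
  where open ColumnEntry u u-inj C C-inj k≤n i C≡u
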